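{- Let $G$ be a connected graph of order $n$ with chromatic number $\chi(G)=k$ and independence number $\alpha(G)=2$, and suppose $G$ has a cut-vertex $u$. Then for every natural number $x\geq k$, $$\pi(G,x)\leq (x)_{\downarrow k}\,(x-1)^{n-k}.$$ Furthermore, equality holds if and only if $G\cong F_{1,k}$ or $G\cong F_{2,k}$.
   Context: All graphs are finite and simple. $\pi(G,x)$ denotes the chromatic polynomial of $G$, which for nonnegative integers $x$ counts the proper colorings $f:V(G)\to\{1,\dots,x\}$. $(x)_{\downarrow k}=x(x-1)\cdots(x-k+1)$. $\alpha(G)$ is the maximum size of a set of pairwise nonadjacent vertices. A cut-vertex is a vertex whose removal disconnects the graph. $F_{1,k}$ is the graph obtained from $K_k$ by attaching a path with one edge to a vertex of the clique; $F_{2,k}$ is the graph obtained from $K_k$ by attaching a path with two edges to a vertex of the clique. -}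

module Defs where

open import Data.Nat using (ℕ; zero; suc; _<_; _≡ᵇ_; _<ᵇ_)
open import Data.Bool using (Bool; true; false; not; _∧_; _∨_)
open import Data.Bool.Properties using () renaming (_≟_ to _≟B_)
open import Data.Fin using (Fin; toℕ)
open import Data.Fin.Properties using (all?) renaming (_≟_ to _≟F_)
open import Data.Vec using (Vec; []; _∷_; lookup)
open import Data.List using (List; [_]; map; concatMap; length; filter; allFin)
open import Data.Product using (Σ; _×_; _,_)
open import Relation.Nullary using (¬_; Dec)
open import Relation.Nullary.Decidable using (¬?; _→-dec_)
open import Relation.Binary.PropositionalEquality using (_≡_; _≢_)
open import Function.Bundles using (_↔_; Inverse)
open import Function.Definitions using (Injective)

record Graph (n : ℕ) : Set where
  field
    adj    : Fin n → Fin n → Bool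
    sym    : ∀ i j → adj i j ≡ adj j i
    irrefl : ∀ i → adj i i ≡ false
open Graph public

Adj : ∀ {n} → Graph n → Fin n → Fin n → Set
Adj G i j = adj G i j ≡ true

ProperColouring : ∀ {n} → Graph n → (x : ℕ) → (Fin n → Fin x) → Set
ProperColouring {n} G x f = ∀ i j → Adj G i j → f i ≢ f j

ProperVec : ∀ {n} {x : ℕ} → Graph n → Vec (Fin x) n → Set
ProperVec G c = ProperColouring G _ (lookup c)

properVec? : ∀ {n} {x : ℕ} (G : Graph n) (c : Vec (Fin x) n) → Dec (ProperVec G c)
properVec? G c = all? (λ i → all? (λ j →
  (adj G i j ≟B true) →-dec ¬? (lookup c i ≟F lookup c j)))

allVecs : (x n : ℕ) → List (Vec (Fin x) n)
allVecs x zero    = [ [] ]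
allVecs x (suc n) = concatMap (λ a → map (a ∷_) (allVecs x n)) (allFin x)

π : ∀ {n} → Graph n → ℕ → ℕ
π {n} G x = length (filter (properVec? G) (allVecs x n))

_↓_ : ℕ → ℕ → ℕ
x ↓ zero = 1
x ↓ suc k = x Data.Nat.* (Data.Nat.pred x ↓ k)

Colourable : ∀ {n} → Graph n → ℕ → Set
Colourable {n} G k = Σ (Fin n → Fin k) (ProperColouring G k)

ChromaticNumber : ∀ {n} → Graph n → ℕ → Set
ChromaticNumber G k = Colourable G k × (∀ m → m < k → ¬ Colourable G m)

HasIndependentSet : ∀ {n} → Graph n → ℕ → Set
HasIndependentSet {n} G m =
  Σ (Fin m → Fin n) λ f → Injective _≡_ _≡_ f × (∀ a b → adj G (f a) (f b) ≡ false)

IndependenceNumber : ∀ {n} → Graph n → ℕ → Set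
IndependenceNumber G a = HasIndependentSet G a × (∀ m → a < m → ¬ HasIndependentSet G m)

data WalkIn {n} (G : Graph n) (P : Fin n → Set) : Fin n → Fin n → Set where
  here : ∀ {v} → P v → WalkIn G P v v
  step : ∀ {u v w} → P u → Adj G u v → WalkIn G P v w → WalkIn G P u w

Everything : ∀ {n} → Fin n → Set
Everything _ = Data.Unit.⊤
  where import Data.Unit

Connected : ∀ {n} → Graph n → Set
Connected G = ∀ v w → WalkIn G Everything v w

CutVertex : ∀ {n} → Graph n → Fin n → Set
CutVertex {n} G u = Σ (Fin n) λ v → Σ (Fin n) λ w →
  v ≢ u × w ≢ u × ¬ WalkIn G (λ z → z ≢ u) v w

IsoTo : ∀ {n m} → Graph n → (Fin m → Fin m → Bool) → Set
IsoTo {n} {m} G H = Σ (Fin n ↔ Fin m) λ φ →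
  ∀ i j → H (Inverse.to φ i) (Inverse.to φ j) ≡ adj G i j

-- F_{1,k}: vertices 0..k-1 form K_k, vertex k is joined to vertex 0.
F₁ : (k : ℕ) → Fin (suc k) → Fin (suc k) → Bool
F₁ k i j = not (a ≡ᵇ b) ∧ (((a <ᵇ k) ∧ (b <ᵇ k)) ∨ e a b ∨ e b a)
  where
  a = toℕ i
  b = toℕ j
  e : ℕ → ℕ → Bool
  e p q = (p ≡ᵇ 0) ∧ (q ≡ᵇ k)

-- F_{2,k}: vertices 0..k-1 form K_k, path 0 — k — (k+1) attached at vertex 0.
F₂ : (k : ℕ) → Fin (suc (suc k)) → Fin (suc (suc k)) → Bool
F₂ k i j = not (a ≡ᵇ b) ∧ (((a <ᵇ k) ∧ (b <ᵇ k)) ∨ e a b ∨ e b a)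
  where
  a = toℕ i
  b = toℕ j
  e : ℕ → ℕ → Bool
  e p q = ((p ≡ᵇ 0) ∧ (q ≡ᵇ k)) ∨ ((p ≡ᵇ k) ∧ (q ≡ᵇ suc k))

-- As α(G) = 2, G − u consists of two cliques, u is joined to every vertex
-- of one of them, X, and the other splits into the neighbours Y₁ ≠ ∅ and the non-neighbours Y₂ of u.
-- Deleting the vertices of Y₂, then X, then Y₁ and finally u, each is simplicial when it is deleted,
-- so with a = |X|, t = |Y₁|, s = |Y₂|
--   π(G, x) = x (x − 1)↓a (x − 1)↓t (x − t)↓s,
-- and reading off for which x this is positive, χ(G) = k is the size of the largest of the cliques
-- {u} ∪ X, {u} ∪ Y₁, Y₁ ∪ Y₂. As (x)↓k (x − 1)^(n−k) = x (x − 1)↓(k−1) (x − 1)^(n−k), the bound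
-- follows by regrouping the n − 1 factors after x into (x − 1)↓(k − 1), supplied by the largest clique,
-- and further factors, each at most x − 1; equality forces all of these to be x − 1, which leaves
-- exactly the part sizes of F₁,k and F₂,k.

module Submission where

open import Defs hiding (sym)
open import Data.Bool using (Bool; true; false; not; _∧_; _∨_) renaming (_≟_ to _≟ᵇ_)
open import Data.Bool.Properties using (∧-zeroʳ; ∨-identityʳ; ¬-not)
open import Data.Fin using (Fin; zero; suc; toℕ; inject₁; punchIn; punchOut; _≟_)
open import Data.Fin.Properties
  using ( all?; any?; 0≢1+n; suc-injective; toℕ-injective; toℕ<n; toℕ-inject₁; inject₁-injective
        ; punchInᵢ≢i; punchIn-injective; punchIn-punchOut)
import Data.Fin.Permutation as Perm
open import Data.List using (List; []; _∷_; _++_; map; concatMap; length; filter; tabulate)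
open import Data.List.Properties using (filter-++; length-++)
open import Data.List.Relation.Unary.All using ([]; _∷_)
open import Data.List.Relation.Unary.All.Properties using (all-filter)
open import Data.Nat using (ℕ; zero; suc; pred; _+_; _*_; _∸_; _^_; _⊔_; _≤_; _<_; z≤n; s≤s; _≡ᵇ_; _<ᵇ_; >-nonZero)
open import Data.Nat.Properties hiding (_≟_; suc-injective; 0≢1+n)
open import Data.Nat.Properties using () renaming (_≟_ to _≟ℕ_)
open import Data.Nat.Tactic.RingSolver using (solve-∀)
open import Data.Product using (Σ; ∃; _×_; _,_; proj₁; proj₂)
open import Data.Sum using (_⊎_; inj₁; inj₂)
open import Data.Vec using (Vec; []; _∷_; lookup; insertAt)
import Data.Vec as Vec
open import Data.Vec.Properties using (insertAt-lookup; insertAt-punchIn; lookup∘tabulate)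
open import Function using (_∘_; _⇔_; mk⇔; Equivalence; _↔_; Inverse; Injection)
open import Function.Properties.Inverse using (↔⇒↣)
open import Relation.Binary.PropositionalEquality
open import Relation.Nullary using (¬_; ¬?; Dec; yes; no; does; _×-dec_; _⊎-dec_; _→-dec_; contradiction)
open import Relation.Nullary.Decidable using (dec-true; dec-false; does-⇔; toWitness)
open import Algebra.Properties.Semiring.Sum +-*-semiring
  using (sum-syntax; sum-cong-≗; ∑-comm; ∑-distrib-+; sum-remove; *-distribˡ-sum; ∑-permute)

𝟙 : Bool → ℕ
𝟙 true  = 1
𝟙 false = 0

𝟙-∧ : ∀ p q → 𝟙 (p ∧ q) ≡ 𝟙 p * 𝟙 q
𝟙-∧ true  q = sym (+-identityʳ (𝟙 q))
𝟙-∧ false q = refl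

does-≟true : ∀ b → does (b ≟ᵇ true) ≡ b
does-≟true true  = refl
does-≟true false = refl

𝟙-dec-complement : ∀ {A B : Set} (a? : Dec A) (b? : Dec B) → (A ⇔ (¬ B)) → 𝟙 (does a?) + 𝟙 (does b?) ≡ 1
𝟙-dec-complement (yes a) (yes b) A⇔¬B = contradiction b (Equivalence.to A⇔¬B a)
𝟙-dec-complement (yes a) (no ¬b) A⇔¬B = refl
𝟙-dec-complement (no ¬a) (yes b) A⇔¬B = refl
𝟙-dec-complement (no ¬a) (no ¬b) A⇔¬B = contradiction (Equivalence.from A⇔¬B ¬b) ¬a

𝟙-guard : ∀ {A : Set} (a? : Dec A) {m k : ℕ} → (A → m ≡ k) → 𝟙 (does a?) * m ≡ k * 𝟙 (does a?)
𝟙-guard (yes a) {m} {k} m≡k = trans (+-identityʳ m) (trans (m≡k a) (sym (*-identityʳ k)))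
𝟙-guard (no  _) {m} {k} _   = sym (*-zeroʳ k)

∑-const-1 : ∀ m → ∑[ i < m ] 1 ≡ m
∑-const-1 zero    = refl
∑-const-1 (suc m) = cong suc (∑-const-1 m)

∑-zero : ∀ m → ∑[ i < m ] 0 ≡ 0
∑-zero zero    = refl
∑-zero (suc m) = ∑-zero m

∑-≥ : ∀ {m} (f : Fin m → ℕ) i → f i ≤ ∑[ j < m ] f j
∑-≥ {suc m} f i rewrite sum-remove {i = i} f = m≤m+n (f i) _

∑-δ : ∀ {m} (c : Fin m) (f : Fin m → ℕ) → ∑[ a < m ] (f a * 𝟙 (does (c ≟ a))) ≡ f c
∑-δ {suc m} c f = begin
  ∑[ a < suc m ] (f a * 𝟙 (does (c ≟ a)))
    ≡⟨ sum-remove {i = c} (λ a → f a * 𝟙 (does (c ≟ a))) ⟩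
  f c * 𝟙 (does (c ≟ c)) + ∑[ j < m ] (f (punchIn c j) * 𝟙 (does (c ≟ punchIn c j)))
    ≡⟨ cong₂ (λ b s → f c * 𝟙 b + s) (dec-true (c ≟ c) refl) (trans (sum-cong-≗ off-diagonal) (∑-zero m)) ⟩
  f c * 1 + 0
    ≡⟨ trans (+-identityʳ (f c * 1)) (*-identityʳ (f c)) ⟩
  f c ∎
  where
  open ≡-Reasoning
  off-diagonal : ∀ j → f (punchIn c j) * 𝟙 (does (c ≟ punchIn c j)) ≡ 0
  off-diagonal j = trans (cong (λ b → f (punchIn c j) * 𝟙 b) (dec-false (c ≟ punchIn c j) (punchInᵢ≢i c j ∘ sym)))
                         (*-zeroʳ (f (punchIn c j)))

𝟙-any?-unique : ∀ {m} {P : Fin m → Set} (P? : ∀ i → Dec (P i)) → (∀ i j → P i → P j → i ≡ j) →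
                𝟙 (does (any? P?)) ≡ ∑[ i < m ] 𝟙 (does (P? i))
𝟙-any?-unique {zero}  P? unique = refl
𝟙-any?-unique {suc m} P? unique with P? zero
... | yes p₀ = cong suc (sym (trans (sum-cong-≗ no-other) (∑-zero m)))
  where
  no-other : ∀ i → 𝟙 (does (P? (suc i))) ≡ 0
  no-other i = cong 𝟙 (dec-false (P? (suc i)) (0≢1+n ∘ unique zero (suc i) p₀))
... | no ¬p₀ = 𝟙-any?-unique (P? ∘ suc) (λ i j pᵢ pⱼ → suc-injective (unique (suc i) (suc j) pᵢ pⱼ))

∑ᵛ : ∀ {x} n → (Vec (Fin x) n → ℕ) → ℕ
∑ᵛ zero    f = f []
∑ᵛ {x} (suc n) f = ∑[ a < x ] ∑ᵛ n (λ r → f (a ∷ r))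

∑ᵛ-cong : ∀ {x} n {f g : Vec (Fin x) n → ℕ} → (∀ c → f c ≡ g c) → ∑ᵛ n f ≡ ∑ᵛ n g
∑ᵛ-cong zero    f≗g = f≗g []
∑ᵛ-cong {x} (suc n) f≗g = sum-cong-≗ {x} (λ a → ∑ᵛ-cong n (λ r → f≗g (a ∷ r)))

∑ᵛ-*ˡ : ∀ {x} n k (f : Vec (Fin x) n → ℕ) → ∑ᵛ n (λ c → k * f c) ≡ k * ∑ᵛ n f
∑ᵛ-*ˡ zero    k f = refl
∑ᵛ-*ˡ {x} (suc n) k f = trans (sum-cong-≗ {x} (λ a → ∑ᵛ-*ˡ n k _)) (sym (*-distribˡ-sum {x} k _))

∑ᵛ-comm : ∀ {x m} n (f : Fin m → Vec (Fin x) n → ℕ) →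
          ∑[ a < m ] ∑ᵛ n (f a) ≡ ∑ᵛ n (λ c → ∑[ a < m ] f a c)
∑ᵛ-comm zero    f = refl
∑ᵛ-comm (suc n) f = trans (∑-comm (λ a b → ∑ᵛ n (λ r → f a (b ∷ r))))
                          (sum-cong-≗ (λ b → ∑ᵛ-comm n (λ a r → f a (b ∷ r))))

∑ᵛ-≥ : ∀ {x} n (f : Vec (Fin x) n → ℕ) c → f c ≤ ∑ᵛ n f
∑ᵛ-≥ zero    f []      = ≤-refl
∑ᵛ-≥ (suc n) f (a ∷ r) = ≤-trans (∑ᵛ-≥ n (λ r → f (a ∷ r)) r) (∑-≥ _ a)

-- Splitting off the colour of an arbitrary vertex v; this is what allows deleting any vertex
-- without appealing to the invariance of π under renumbering the vertices.
∑ᵛ-insertAt : ∀ {x} n (v : Fin (suc n)) (f : Vec (Fin x) (suc n) → ℕ) →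
              ∑ᵛ (suc n) f ≡ ∑[ a < x ] ∑ᵛ n (λ r → f (insertAt r v a))
∑ᵛ-insertAt n       zero    f = refl
∑ᵛ-insertAt (suc n) (suc v) f =
  trans (sum-cong-≗ (λ b → ∑ᵛ-insertAt n v (λ r → f (b ∷ r))))
        (∑-comm (λ b a → ∑ᵛ n (λ r → f (b ∷ insertAt r v a))))

module _ {A : Set} {P : A → Set} (P? : ∀ a → Dec (P a)) where

  length-filter-++ : ∀ xs ys → length (filter P? (xs ++ ys)) ≡ length (filter P? xs) + length (filter P? ys)
  length-filter-++ xs ys = trans (cong length (filter-++ P? xs ys)) (length-++ (filter P? xs))

  length-filter-concatMap : ∀ {B : Set} {m} (g : B → List A) (h : Fin m → B) →
    length (filter P? (concatMap g (tabulate h))) ≡ ∑[ i < m ] length (filter P? (g (h i)))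
  length-filter-concatMap {m = zero}  g h = refl
  length-filter-concatMap {m = suc m} g h =
    trans (length-filter-++ (g (h zero)) _) (cong (length (filter P? (g (h zero))) +_) (length-filter-concatMap g (h ∘ suc)))

length-filter-map : ∀ {A B : Set} {P : B → Set} (P? : ∀ b → Dec (P b)) (f : A → B) xs →
  length (filter P? (map f xs)) ≡ length (filter (P? ∘ f) xs)
length-filter-map P? f []       = refl
length-filter-map P? f (x ∷ xs) with does (P? (f x))
... | true  = cong suc (length-filter-map P? f xs)
... | false = length-filter-map P? f xs

length-filter-allVecs : ∀ {x} n {P : Vec (Fin x) n → Set} (P? : ∀ c → Dec (P c)) →
  length (filter P? (allVecs x n)) ≡ ∑ᵛ n (λ c → 𝟙 (does (P? c)))
length-filter-allVecs zero P? with P? []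
... | yes _ = refl
... | no  _ = refl
length-filter-allVecs {x} (suc n) P? =
  trans (length-filter-concatMap P? (λ a → map (a ∷_) (allVecs x n)) (λ a → a))
        (sum-cong-≗ (λ a → trans (length-filter-map P? (a ∷_) (allVecs x n)) (length-filter-allVecs n (P? ∘ (a ∷_)))))

π≡∑ᵛ : ∀ {n} (G : Graph n) x → π G x ≡ ∑ᵛ n (λ c → 𝟙 (does (properVec? G c)))
π≡∑ᵛ {n} G x = length-filter-allVecs n (properVec? G)

π-empty : (G : Graph 0) → ∀ x → π G x ≡ 1
π-empty G x = trans (π≡∑ᵛ G x) (cong 𝟙 (dec-true (properVec? {x = x} G []) λ ()))

colourable⇒π-positive : ∀ {n} (G : Graph n) m → Colourable G m → 0 < π G m
colourable⇒π-positive {n} G m (f , proper) = begin-strict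
  0                                          <⟨ s≤s z≤n ⟩
  1                                          ≡⟨ sym c-proper ⟩
  𝟙 (does (properVec? G c))                  ≤⟨ ∑ᵛ-≥ n (λ d → 𝟙 (does (properVec? G d))) c ⟩
  ∑ᵛ n (λ d → 𝟙 (does (properVec? G d)))     ≡⟨ sym (π≡∑ᵛ G m) ⟩
  π G m                                      ∎
  where
  open ≤-Reasoning
  c = Vec.tabulate f
  lookup-c : ∀ i → lookup c i ≡ f i
  lookup-c = lookup∘tabulate f
  c-proper : 𝟙 (does (properVec? G c)) ≡ 1
  c-proper = cong 𝟙 (dec-true (properVec? G c) λ i j e eq → proper i j e (trans (sym (lookup-c i)) (trans eq (lookup-c j))))

π-positive⇒colourable : ∀ {n} (G : Graph n) m → 0 < π G m → Colourable G m
π-positive⇒colourable {n} G m pos with filter (properVec? G) (allVecs m n) | all-filter (properVec? G) (allVecs m n)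
... | []    | []         = contradiction pos λ ()
... | c ∷ _ | proper ∷ _ = lookup c , proper

-- Deleting a simplicial vertex

_─_ : ∀ {n} → Graph (suc n) → Fin (suc n) → Graph n
G ─ v = record
  { adj    = λ i j → adj G (punchIn v i) (punchIn v j)
  ; sym    = λ i j → Graph.sym G (punchIn v i) (punchIn v j)
  ; irrefl = λ i → irrefl G (punchIn v i)
  }

degree : ∀ {n} → Graph (suc n) → Fin (suc n) → ℕ
degree {n} G v = ∑[ j < n ] 𝟙 (adj G v (punchIn v j))

Simplicial : ∀ {n} → Graph (suc n) → Fin (suc n) → Set
Simplicial G v = ∀ i j → i ≢ j → Adj G v (punchIn v i) → Adj G v (punchIn v j) → Adj (G ─ v) i j

punchIn-view : ∀ {n} (v i : Fin (suc n)) → i ≡ v ⊎ Σ (Fin n) (λ j → punchIn v j ≡ i)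
punchIn-view v i with i ≟ v
... | yes i≡v = inj₁ i≡v
... | no  i≢v = inj₂ (punchOut (i≢v ∘ sym) , punchIn-punchOut (i≢v ∘ sym))

module _ {n x : ℕ} (G : Graph (suc n)) (v : Fin (suc n)) where

  Avoids : Fin x → Vec (Fin x) n → Set
  Avoids a r = ∀ j → Adj G v (punchIn v j) → lookup r j ≢ a

  avoids? : ∀ a r → Dec (Avoids a r)
  avoids? a r = all? (λ j → (adj G v (punchIn v j) ≟ᵇ true) →-dec ¬? (lookup r j ≟ a))

  properVec-insertAt : ∀ a r → ProperVec G (insertAt r v a) ⇔ (ProperVec (G ─ v) r × Avoids a r)
  properVec-insertAt a r = mk⇔ (λ P → (λ i j e → P _ _ e ∘ at-punchIn i j) , (λ j e → P v _ e ∘ at-v j)) from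
    where
    c = insertAt r v a
    at-punchIn : ∀ i j → lookup r i ≡ lookup r j → lookup c (punchIn v i) ≡ lookup c (punchIn v j)
    at-punchIn i j eq = trans (insertAt-punchIn r v a i) (trans eq (sym (insertAt-punchIn r v a j)))
    at-v : ∀ j → lookup r j ≡ a → lookup c v ≡ lookup c (punchIn v j)
    at-v j eq = trans (insertAt-lookup r v a) (trans (sym eq) (sym (insertAt-punchIn r v a j)))
    from : ProperVec (G ─ v) r × Avoids a r → ProperVec G c
    from (P , A) i j e with punchIn-view v i | punchIn-view v j
    ... | inj₁ refl | inj₁ refl with () ← trans (sym e) (irrefl G v)
    ... | inj₁ refl        | inj₂ (j′ , refl) = λ eq →
      A j′ e (trans (sym (insertAt-punchIn r v a j′)) (trans (sym eq) (insertAt-lookup r v a)))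
    ... | inj₂ (i′ , refl) | inj₁ refl        = λ eq →
      A i′ (trans (Graph.sym G v _) e) (trans (sym (insertAt-punchIn r v a i′)) (trans eq (insertAt-lookup r v a)))
    ... | inj₂ (i′ , refl) | inj₂ (j′ , refl) = λ eq →
      P i′ j′ e (trans (sym (insertAt-punchIn r v a i′)) (trans eq (insertAt-punchIn r v a j′)))

  𝟙-properVec-insertAt : ∀ a r →
    𝟙 (does (properVec? G (insertAt r v a))) ≡ 𝟙 (does (properVec? (G ─ v) r)) * 𝟙 (does (avoids? a r))
  𝟙-properVec-insertAt a r =
    trans (cong 𝟙 (does-⇔ (properVec-insertAt a r) (properVec? G (insertAt r v a)) (properVec? (G ─ v) r ×-dec avoids? a r)))
          (𝟙-∧ (does (properVec? (G ─ v) r)) (does (avoids? a r)))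

  -- When the neighbourhood of v is a clique coloured properly, its colours are distinct,
  -- so exactly degree G v colours are unavailable for v.
  ∑-avoids : Simplicial G v → ∀ r → ProperVec (G ─ v) r → ∑[ a < x ] 𝟙 (does (avoids? a r)) ≡ x ∸ degree G v
  ∑-avoids simplicial r P = begin
    ∑[ a < x ] avoiding a
      ≡⟨ sym (m+n∸n≡m (∑[ a < x ] avoiding a) (degree G v)) ⟩
    ∑[ a < x ] avoiding a + degree G v ∸ degree G v
      ≡⟨ cong (λ d → ∑[ a < x ] avoiding a + d ∸ degree G v) (sym ∑-clashes) ⟩
    ∑[ a < x ] avoiding a + ∑[ a < x ] clashing a ∸ degree G v
      ≡⟨ cong (_∸ degree G v) avoiding+clashing ⟩
    x ∸ degree G v ∎
    where
    open ≡-Reasoning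
    clash? : ∀ a j → Dec (Adj G v (punchIn v j) × lookup r j ≡ a)
    clash? a j = (adj G v (punchIn v j) ≟ᵇ true) ×-dec (lookup r j ≟ a)
    avoiding clashing : Fin x → ℕ
    avoiding a = 𝟙 (does (avoids? a r))
    clashing a = 𝟙 (does (any? (clash? a)))
    avoids⇔¬clash : ∀ a → Avoids a r ⇔ (¬ ∃ λ j → Adj G v (punchIn v j) × lookup r j ≡ a)
    avoids⇔¬clash a = mk⇔ (λ A (j , e , eq) → A j e eq) (λ ¬C j e eq → ¬C (j , e , eq))
    avoiding+clashing : ∑[ a < x ] avoiding a + ∑[ a < x ] clashing a ≡ x
    avoiding+clashing = trans (sym (∑-distrib-+ avoiding clashing))
      (trans (sum-cong-≗ {x} (λ a → 𝟙-dec-complement (avoids? a r) (any? (clash? a)) (avoids⇔¬clash a))) (∑-const-1 x))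
    unique-clash : ∀ a i j → Adj G v (punchIn v i) × lookup r i ≡ a → Adj G v (punchIn v j) × lookup r j ≡ a → i ≡ j
    unique-clash a i j (eᵢ , eqᵢ) (eⱼ , eqⱼ) with i ≟ j
    ... | yes i≡j = i≡j
    ... | no  i≢j = contradiction (trans eqᵢ (sym eqⱼ)) (P i j (simplicial i j i≢j eᵢ eⱼ))
    ∑-clashes : ∑[ a < x ] clashing a ≡ degree G v
    ∑-clashes = begin
      ∑[ a < x ] clashing a
        ≡⟨ sum-cong-≗ {x} (λ a → 𝟙-any?-unique (clash? a) (unique-clash a)) ⟩
      ∑[ a < x ] ∑[ j < n ] 𝟙 (does (clash? a j))
        ≡⟨ ∑-comm (λ a j → 𝟙 (does (clash? a j))) ⟩
      ∑[ j < n ] ∑[ a < x ] 𝟙 (does (clash? a j))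
        ≡⟨ sum-cong-≗ {n} (λ j → neighbour-colour j) ⟩
      degree G v ∎
      where
      neighbour-colour : ∀ j → ∑[ a < x ] 𝟙 (does (clash? a j)) ≡ 𝟙 (adj G v (punchIn v j))
      neighbour-colour j = trans (sum-cong-≗ {x} (λ a → 𝟙-∧ (does (adj G v (punchIn v j) ≟ᵇ true)) (does (lookup r j ≟ a))))
                                 (trans (∑-δ (lookup r j) (λ _ → 𝟙 (does (adj G v (punchIn v j) ≟ᵇ true))))
                                        (cong 𝟙 (does-≟true _)))

π-delete-simplicial : ∀ {n} (G : Graph (suc n)) v → Simplicial G v → ∀ x → π G x ≡ (x ∸ degree G v) * π (G ─ v) x
π-delete-simplicial {n} G v simplicial x = begin
  π G x
    ≡⟨ π≡∑ᵛ G x ⟩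
  ∑ᵛ {x} (suc n) (λ c → 𝟙 (does (properVec? G c)))
    ≡⟨ ∑ᵛ-insertAt {x} n v (λ c → 𝟙 (does (properVec? G c))) ⟩
  ∑[ a < x ] ∑ᵛ n (λ r → 𝟙 (does (properVec? G (insertAt r v a))))
    ≡⟨ sum-cong-≗ {x} (λ a → ∑ᵛ-cong n (𝟙-properVec-insertAt G v a)) ⟩
  ∑[ a < x ] ∑ᵛ n (λ r → proper r * 𝟙 (does (avoids? G v a r)))
    ≡⟨ ∑ᵛ-comm n (λ a r → proper r * 𝟙 (does (avoids? G v a r))) ⟩
  ∑ᵛ n (λ r → ∑[ a < x ] (proper r * 𝟙 (does (avoids? G v a r))))
    ≡⟨ ∑ᵛ-cong n (λ r → sym (*-distribˡ-sum (proper r) (λ a → 𝟙 (does (avoids? G v a r))))) ⟩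
  ∑ᵛ n (λ r → proper r * ∑[ a < x ] 𝟙 (does (avoids? G v a r)))
    ≡⟨ ∑ᵛ-cong n count-avoiding ⟩
  ∑ᵛ n (λ r → (x ∸ degree G v) * proper r)
    ≡⟨ ∑ᵛ-*ˡ n (x ∸ degree G v) proper ⟩
  (x ∸ degree G v) * ∑ᵛ n proper
    ≡⟨ cong ((x ∸ degree G v) *_) (sym (π≡∑ᵛ (G ─ v) x)) ⟩
  (x ∸ degree G v) * π (G ─ v) x ∎
  where
  open ≡-Reasoning
  proper : Vec (Fin x) n → ℕ
  proper r = 𝟙 (does (properVec? (G ─ v) r))
  count-avoiding : ∀ r → proper r * ∑[ a < x ] 𝟙 (does (avoids? G v a r)) ≡ (x ∸ degree G v) * proper r
  count-avoiding r = 𝟙-guard (properVec? (G ─ v) r) (∑-avoids G v simplicial r)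

*-positive : ∀ {m n} → 0 < m → 0 < n → 0 < m * n
*-positive {suc m} {suc n} _ _ = s≤s z≤n

positive-*ˡ : ∀ m n → 0 < m * n → 0 < m
positive-*ˡ (suc m) n _ = s≤s z≤n

positive-*ʳ : ∀ m n → 0 < m * n → 0 < n
positive-*ʳ m n pos = positive-*ˡ n m (subst (0 <_) (*-comm m n) pos)

m+n≤o⇒n≤o∸m : ∀ m {n o} → m + n ≤ o → n ≤ o ∸ m
m+n≤o⇒n≤o∸m m {n} m+n≤o = subst (_≤ _ ∸ m) (m+n∸m≡n m n) (∸-monoˡ-≤ m m+n≤o)

∸-pred : ∀ y s → pred y ∸ s ≡ y ∸ suc s
∸-pred zero    zero    = refl
∸-pred zero    (suc s) = refl
∸-pred (suc y) s       = refl

↓-suc : ∀ y s → y ↓ suc s ≡ y ↓ s * (y ∸ s)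
↓-suc y zero    = trans (*-identityʳ y) (sym (+-identityʳ y))
↓-suc y (suc s) = begin
  y * pred y ↓ suc s                 ≡⟨ cong (y *_) (↓-suc (pred y) s) ⟩
  y * (pred y ↓ s * (pred y ∸ s))    ≡⟨ sym (*-assoc y _ _) ⟩
  y * pred y ↓ s * (pred y ∸ s)      ≡⟨ cong (y * pred y ↓ s *_) (∸-pred y s) ⟩
  y * pred y ↓ s * (y ∸ suc s)       ∎
  where open ≡-Reasoning

↓-suc-∸ : ∀ y m s → (y ∸ m) ↓ suc s ≡ (y ∸ m) ↓ s * (y ∸ (m + s))
↓-suc-∸ y m s = trans (↓-suc (y ∸ m) s) (cong ((y ∸ m) ↓ s *_) (∸-+-assoc y m s))

↓-+ : ∀ y p q → y ↓ (p + q) ≡ y ↓ p * (y ∸ p) ↓ q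
↓-+ y zero    q = sym (+-identityʳ (y ↓ q))
↓-+ y (suc p) q = trans (cong (y *_) (↓-+ (pred y) p q))
                        (trans (sym (*-assoc y _ _)) (cong (λ z → y * pred y ↓ p * z ↓ q) (∸-pred y p)))

↓≤^ : ∀ y p → y ↓ p ≤ y ^ p
↓≤^ y zero    = ≤-refl
↓≤^ y (suc p) = *-monoʳ-≤ y (≤-trans (↓≤^ (pred y) p) (^-monoˡ-≤ p pred[n]≤n))

↓-positive : ∀ {y p} → p ≤ y → 0 < y ↓ p
↓-positive {y}     {zero}  _         = s≤s z≤n
↓-positive {suc y} {suc p} (s≤s p≤y) = *-positive {suc y} (s≤s z≤n) (↓-positive p≤y)

↓-positive⇒≤ : ∀ y p → 0 < y ↓ p → p ≤ y
↓-positive⇒≤ y       zero    _ = z≤n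
↓-positive⇒≤ (suc y) (suc p) pos = s≤s (↓-positive⇒≤ y p (positive-*ʳ (suc y) (y ↓ p) pos))

↓≡^⇒≤1 : ∀ {y} p → 1 ≤ y → y ↓ p ≡ y ^ p → p ≤ 1
↓≡^⇒≤1         zero          _   _  = z≤n
↓≡^⇒≤1         (suc zero)    _   _  = ≤-refl
↓≡^⇒≤1 {suc y} (suc (suc p)) 1≤y eq = contradiction eq (<⇒≢ (begin-strict
  suc y ↓ suc (suc p)             ≡⟨ ↓-suc (suc y) (suc p) ⟩
  suc y ↓ suc p * (y ∸ p)         ≤⟨ *-monoˡ-≤ (y ∸ p) (↓≤^ (suc y) (suc p)) ⟩
  suc y ^ suc p * (y ∸ p)         <⟨ *-monoʳ-< (suc y ^ suc p) {{>-nonZero (m^n>0 (suc y) (suc p))}} (s≤s (m∸n≤m y p)) ⟩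
  suc y ^ suc p * suc y           ≡⟨ *-comm (suc y ^ suc p) (suc y) ⟩
  suc y ^ suc (suc p)             ∎))
  where open ≤-Reasoning

∸≡⇒≡0 : ∀ {y} c → 1 ≤ y → y ∸ c ≡ y → c ≡ 0
∸≡⇒≡0         zero    _ _  = refl
∸≡⇒≡0 {suc y} (suc c) _ eq = contradiction eq (<⇒≢ (s≤s (m∸n≤m y c)))

*-≤-tight : ∀ {A B C D} → A ≤ C → B ≤ D → 0 < B → 0 < C → A * B ≡ C * D → A ≡ C × B ≡ D
*-≤-tight {A} {B} {C} {D} A≤C B≤D 0<B 0<C eq with A <? C
... | yes A<C = contradiction eq (<⇒≢ (<-≤-trans (*-monoˡ-< B {{>-nonZero 0<B}} A<C) (*-monoʳ-≤ C B≤D)))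
... | no  A≮C = A≡C , *-cancelˡ-≡ B D C {{>-nonZero 0<C}} (subst (λ z → z * B ≡ C * D) A≡C eq)
  where A≡C = ≤-antisym A≤C (≮⇒≥ A≮C)

-- Graphs built from four parts

-- The parts of a graph with a cut vertex and independence number 2: the cut vertex U, a clique X
-- joined to U, and a clique Y split into the neighbours Y₁ and the non-neighbours Y₂ of U.
-- Declaring U ~ U only matters for labellings with several U-vertices, which it keeps chordal.
Part : Set
Part = Fin 4

pattern U  = zero
pattern X  = suc zero
pattern Y₁ = suc (suc zero)
pattern Y₂ = suc (suc (suc zero))

joined : Part → Part → Bool
joined U  U  = true
joined U  X  = true
joined U  Y₁ = true
joined X  U  = true
joined X  X  = true
joined Y₁ U  = true
joined Y₁ Y₁ = true
joined Y₁ Y₂ = true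
joined Y₂ Y₁ = true
joined Y₂ Y₂ = true
joined _  _  = false

-- The order Y₂, X, Y₁, U in which vertices are deleted when computing the chromatic polynomial.
rank : Part → ℕ
rank Y₂ = 0
rank X  = 1
rank Y₁ = 2
rank U  = 3

joined-upward-closed : ∀ p q r → rank p ≤ rank q → rank p ≤ rank r →
                       joined p q ≡ true → joined p r ≡ true → joined q r ≡ true
joined-upward-closed = toWitness {a? = all? λ p → all? λ q → all? λ r →
  (rank p ≤? rank q) →-dec ((rank p ≤? rank r) →-dec
    ((joined p q ≟ᵇ true) →-dec ((joined p r ≟ᵇ true) →-dec (joined q r ≟ᵇ true))))} _

Shaped : ∀ {n} → (Fin n → Fin n → Bool) → (Fin n → Part) → Set
Shaped A L = ∀ i j → i ≢ j → A i j ≡ joined (L i) (L j)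

size : ∀ {n} → (Fin n → Part) → Part → ℕ
size {n} L p = ∑[ i < n ] 𝟙 (does (L i ≟ p))

size-punchIn : ∀ {n} (L : Fin (suc n) → Part) v p → size L p ≡ 𝟙 (does (L v ≟ p)) + size (L ∘ punchIn v) p
size-punchIn L v p = sum-remove {i = v} (λ i → 𝟙 (does (L i ≟ p)))

size-absent : ∀ {n} (L : Fin n → Part) p → (∀ i → L i ≢ p) → size L p ≡ 0
size-absent {n} L p absent = trans (sum-cong-≗ (λ i → cong 𝟙 (dec-false (L i ≟ p) (absent i)))) (∑-zero n)

Shaped-─ : ∀ {n} {G : Graph (suc n)} {L} v → Shaped (adj G) L → Shaped (adj (G ─ v)) (L ∘ punchIn v)
Shaped-─ v shaped i j i≢j = shaped (punchIn v i) (punchIn v j) (i≢j ∘ punchIn-injective v i j)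

degree-shaped : ∀ {n} {G : Graph (suc n)} {L} v → Shaped (adj G) L →
                degree G v ≡ ∑[ q < 4 ] (𝟙 (joined (L v) q) * size (L ∘ punchIn v) q)
degree-shaped {n} {G} {L} v shaped = begin
  ∑[ j < n ] 𝟙 (adj G v (punchIn v j))
    ≡⟨ sum-cong-≗ (λ j → cong 𝟙 (shaped v (punchIn v j) (punchInᵢ≢i v j ∘ sym))) ⟩
  ∑[ j < n ] 𝟙 (joined (L v) (L (punchIn v j)))
    ≡⟨ sum-cong-≗ (λ j → sym (∑-δ (L (punchIn v j)) (λ q → 𝟙 (joined (L v) q)))) ⟩
  ∑[ j < n ] ∑[ q < 4 ] (𝟙 (joined (L v) q) * 𝟙 (does (L (punchIn v j) ≟ q)))
    ≡⟨ ∑-comm (λ j q → 𝟙 (joined (L v) q) * 𝟙 (does (L (punchIn v j) ≟ q))) ⟩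
  ∑[ q < 4 ] ∑[ j < n ] (𝟙 (joined (L v) q) * 𝟙 (does (L (punchIn v j) ≟ q)))
    ≡⟨ sum-cong-≗ {4} (λ q → sym (*-distribˡ-sum (𝟙 (joined (L v) q)) (λ j → 𝟙 (does (L (punchIn v j) ≟ q))))) ⟩
  ∑[ q < 4 ] (𝟙 (joined (L v) q) * size (L ∘ punchIn v) q) ∎
  where open ≡-Reasoning

lowest : ∀ {n} (L : Fin (suc n) → Part) → Σ (Fin (suc n)) λ v → ∀ i → rank (L v) ≤ rank (L i)
lowest {zero}  L = zero , λ { zero → ≤-refl }
lowest {suc n} L with lowest (L ∘ suc)
... | v , min with rank (L zero) ≤? rank (L (suc v))
...   | yes L₀≤ = zero , λ { zero → ≤-refl ; (suc i) → ≤-trans L₀≤ (min i) }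
...   | no  L₀≰ = suc v , λ { zero → <⇒≤ (≰⇒> L₀≰) ; (suc i) → min i }

simplicial-lowest : ∀ {n} {G : Graph (suc n)} {L} v → Shaped (adj G) L → (∀ i → rank (L v) ≤ rank (L i)) → Simplicial G v
simplicial-lowest {G = G} {L} v shaped min i j i≢j vi vj =
  trans (Shaped-─ {G = G} v shaped i j i≢j)
        (joined-upward-closed (L v) _ _ (min (punchIn v i)) (min (punchIn v j))
           (trans (sym (shaped v (punchIn v i) (punchInᵢ≢i v i ∘ sym))) vi)
           (trans (sym (shaped v (punchIn v j) (punchInᵢ≢i v j ∘ sym))) vj))

shapeπ : ℕ → (Part → ℕ) → ℕ
shapeπ x c = x ↓ c U * ((x ∸ c U) ↓ c X * ((x ∸ c U) ↓ c Y₁ * (x ∸ c Y₁) ↓ c Y₂))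

shapeπ-cong : ∀ x {c d : Part → ℕ} → (∀ p → c p ≡ d p) → shapeπ x c ≡ shapeπ x d
shapeπ-cong x c≗d rewrite c≗d U | c≗d X | c≗d Y₁ | c≗d Y₂ = refl

-- Adding a vertex of the lowest part present multiplies by one factor x − (its degree).
shapeπ-step : ∀ x p (c : Part → ℕ) → (∀ q → rank q < rank p → c q ≡ 0) →
  shapeπ x (λ q → 𝟙 (does (p ≟ q)) + c q) ≡ (x ∸ ∑[ q < 4 ] (𝟙 (joined p q) * c q)) * shapeπ x c
shapeπ-step x Y₂ c absent = begin
  A * (B * (C * (x ∸ c Y₁) ↓ suc (c Y₂)))
    ≡⟨ cong (λ z → A * (B * (C * z))) (↓-suc-∸ x (c Y₁) (c Y₂)) ⟩
  A * (B * (C * ((x ∸ c Y₁) ↓ c Y₂ * (x ∸ (c Y₁ + c Y₂)))))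
    ≡⟨ pull-last A B C ((x ∸ c Y₁) ↓ c Y₂) (x ∸ (c Y₁ + c Y₂)) ⟩
  (x ∸ (c Y₁ + c Y₂)) * shapeπ x c
    ≡⟨ cong (λ d → (x ∸ d) * shapeπ x c) (neighbours (c Y₁) (c Y₂)) ⟩
  (x ∸ ∑[ q < 4 ] (𝟙 (joined Y₂ q) * c q)) * shapeπ x c ∎
  where
  open ≡-Reasoning
  A = x ↓ c U
  B = (x ∸ c U) ↓ c X
  C = (x ∸ c U) ↓ c Y₁
  pull-last : ∀ A B C D e → A * (B * (C * (D * e))) ≡ e * (A * (B * (C * D)))
  pull-last = solve-∀
  neighbours : ∀ t s → t + s ≡ 1 * t + (1 * s + 0)
  neighbours = solve-∀
-- In the remaining cases the rewriting normalises the degree ∑[ q < 4 ] … to an explicit sum.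
shapeπ-step x X c absent rewrite absent Y₂ (s≤s z≤n) = begin
  A * ((x ∸ c U) ↓ suc (c X) * C)
    ≡⟨ cong (λ z → A * (z * C)) (↓-suc-∸ x (c U) (c X)) ⟩
  A * ((x ∸ c U) ↓ c X * (x ∸ (c U + c X)) * C)
    ≡⟨ pull-middle A ((x ∸ c U) ↓ c X) C (x ∸ (c U + c X)) ⟩
  (x ∸ (c U + c X)) * (A * ((x ∸ c U) ↓ c X * C))
    ≡⟨ cong (λ d → (x ∸ d) * (A * ((x ∸ c U) ↓ c X * C))) (neighbours (c U) (c X)) ⟩
  (x ∸ (1 * c U + (1 * c X + 0))) * (A * ((x ∸ c U) ↓ c X * C)) ∎
  where
  open ≡-Reasoning
  A = x ↓ c U
  C = (x ∸ c U) ↓ c Y₁ * 1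
  pull-middle : ∀ A B C e → A * (B * e * C) ≡ e * (A * (B * C))
  pull-middle = solve-∀
  neighbours : ∀ u a → u + a ≡ 1 * u + (1 * a + 0)
  neighbours = solve-∀
shapeπ-step x Y₁ c absent rewrite absent Y₂ (s≤s z≤n) | absent X (s≤s (s≤s z≤n)) = begin
  A * (1 * ((x ∸ c U) ↓ suc (c Y₁) * 1))
    ≡⟨ cong (λ z → A * (1 * (z * 1))) (↓-suc-∸ x (c U) (c Y₁)) ⟩
  A * (1 * ((x ∸ c U) ↓ c Y₁ * (x ∸ (c U + c Y₁)) * 1))
    ≡⟨ pull-inner A ((x ∸ c U) ↓ c Y₁) (x ∸ (c U + c Y₁)) ⟩
  (x ∸ (c U + c Y₁)) * (A * (1 * ((x ∸ c U) ↓ c Y₁ * 1)))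
    ≡⟨ cong (λ d → (x ∸ d) * (A * (1 * ((x ∸ c U) ↓ c Y₁ * 1)))) (neighbours (c U) (c Y₁)) ⟩
  (x ∸ (1 * c U + (1 * c Y₁ + (1 * 0 + 0)))) * (A * (1 * ((x ∸ c U) ↓ c Y₁ * 1))) ∎
  where
  open ≡-Reasoning
  A = x ↓ c U
  pull-inner : ∀ A C e → A * (1 * (C * e * 1)) ≡ e * (A * (1 * (C * 1)))
  pull-inner = solve-∀
  neighbours : ∀ u t → u + t ≡ 1 * u + (1 * t + (1 * 0 + 0))
  neighbours = solve-∀
shapeπ-step x U c absent rewrite absent Y₂ (s≤s z≤n) | absent X (s≤s (s≤s z≤n)) | absent Y₁ (s≤s (s≤s (s≤s z≤n))) = begin
  x ↓ suc (c U) * 1                   ≡⟨ cong (_* 1) (↓-suc x (c U)) ⟩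
  x ↓ c U * (x ∸ c U) * 1             ≡⟨ pull-outer (x ↓ c U) (x ∸ c U) ⟩
  (x ∸ c U) * (x ↓ c U * 1)           ≡⟨ cong (λ d → (x ∸ d) * (x ↓ c U * 1)) (neighbours (c U)) ⟩
  (x ∸ (1 * c U + (1 * 0 + (1 * 0 + 0)))) * (x ↓ c U * 1) ∎
  where
  open ≡-Reasoning
  pull-outer : ∀ A e → A * e * 1 ≡ e * (A * 1)
  pull-outer = solve-∀
  neighbours : ∀ u → u ≡ 1 * u + (1 * 0 + (1 * 0 + 0))
  neighbours = solve-∀

π-shaped : ∀ {n} (G : Graph n) (L : Fin n → Part) → Shaped (adj G) L → ∀ x → π G x ≡ shapeπ x (size L)
π-shaped {zero}  G L _      x = π-empty G x
π-shaped {suc n} G L shaped x with lowest L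
... | v , min = begin
  π G x
    ≡⟨ π-delete-simplicial G v (simplicial-lowest {G = G} v shaped min) x ⟩
  (x ∸ degree G v) * π (G ─ v) x
    ≡⟨ cong₂ (λ d p → (x ∸ d) * p) (degree-shaped {G = G} v shaped) (π-shaped (G ─ v) L′ (Shaped-─ {G = G} v shaped) x) ⟩
  (x ∸ ∑[ q < 4 ] (𝟙 (joined (L v) q) * size L′ q)) * shapeπ x (size L′)
    ≡⟨ sym (shapeπ-step x (L v) (size L′) absent) ⟩
  shapeπ x (λ q → 𝟙 (does (L v ≟ q)) + size L′ q)
    ≡⟨ sym (shapeπ-cong x (size-punchIn L v)) ⟩
  shapeπ x (size L) ∎
  where
  open ≡-Reasoning
  L′ = L ∘ punchIn v
  absent : ∀ q → rank q < rank (L v) → size L′ q ≡ 0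
  absent q q<v = size-absent L′ q (λ i L′i≡q → <⇒≱ q<v (subst (λ p → rank (L v) ≤ rank p) L′i≡q (min (punchIn v i))))

size-≥1 : ∀ {n} (L : Fin n → Part) i → 1 ≤ size L (L i)
size-≥1 {suc n} L i rewrite size-punchIn L i (L i) | dec-true (L i ≟ L i) refl = s≤s z≤n

occurs : ∀ {n} (L : Fin n → Part) p → 1 ≤ size L p → Σ (Fin n) λ i → L i ≡ p
occurs L p 1≤size with any? (λ i → L i ≟ p)
... | yes found = found
... | no  none  = contradiction (size-absent L p (λ i Li≡p → none (i , Li≡p))) (λ size≡0 → <⇒≢ 1≤size (sym size≡0))

part-preserving-↔ : ∀ {n m} (L₁ : Fin n → Part) (L₂ : Fin m → Part) → (∀ p → size L₁ p ≡ size L₂ p) →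
  Σ (Fin n ↔ Fin m) λ φ → ∀ i → L₂ (Inverse.to φ i) ≡ L₁ i
part-preserving-↔ {zero} {zero}  L₁ L₂ same = Perm.id , λ ()
part-preserving-↔ {zero} {suc m} L₁ L₂ same = contradiction (same (L₂ zero)) (<⇒≢ (size-≥1 L₂ zero))
part-preserving-↔ {suc n} {m} L₁ L₂ same with occurs L₂ (L₁ zero) (subst (1 ≤_) (same (L₁ zero)) (size-≥1 L₁ zero))
part-preserving-↔ {suc n} {suc m} L₁ L₂ same | w , L₂w≡L₁0 =
  let ψ , preserves = part-preserving-↔ (L₁ ∘ suc) (L₂ ∘ punchIn w) same′ in
  Perm.insert zero w ψ , λ { zero → L₂w≡L₁0 ; (suc i) → trans (cong L₂ (Perm.insert-punchIn zero w ψ i)) (preserves i) }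
  where
  same′ : ∀ p → size (L₁ ∘ suc) p ≡ size (L₂ ∘ punchIn w) p
  same′ p = +-cancelˡ-≡ (𝟙 (does (L₁ zero ≟ p))) _ _
    (trans (same p) (trans (size-punchIn L₂ w p) (cong (λ q → 𝟙 (does (q ≟ p)) + size (L₂ ∘ punchIn w) p) L₂w≡L₁0)))

shaped-iso : ∀ {n m} (G : Graph n) (H : Fin m → Fin m → Bool) (L₁ : Fin n → Part) (L₂ : Fin m → Part) →
  Shaped (adj G) L₁ → (∀ i → H i i ≡ false) → Shaped H L₂ → (∀ p → size L₁ p ≡ size L₂ p) → IsoTo G H
shaped-iso G H L₁ L₂ G-shaped H-irrefl H-shaped same = φ , preserves-adj
  where
  parts = part-preserving-↔ L₁ L₂ same
  φ = proj₁ parts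
  to = Inverse.to φ
  preserves-adj : ∀ i j → H (to i) (to j) ≡ adj G i j
  preserves-adj i j with i ≟ j
  ... | yes refl = trans (H-irrefl (to i)) (sym (irrefl G i))
  ... | no  i≢j  = begin
    H (to i) (to j)                ≡⟨ H-shaped (to i) (to j) (i≢j ∘ Injection.injective (↔⇒↣ φ)) ⟩
    joined (L₂ (to i)) (L₂ (to j)) ≡⟨ cong₂ joined (proj₂ parts i) (proj₂ parts j) ⟩
    joined (L₁ i) (L₁ j)           ≡⟨ sym (G-shaped i j i≢j) ⟩
    adj G i j                      ∎
    where open ≡-Reasoning

shaped-pullback : ∀ {n m} (G : Graph n) (H : Fin m → Fin m → Bool) (L : Fin m → Part) → Shaped H L →
  ((φ , _) : IsoTo G H) → Shaped (adj G) (L ∘ Inverse.to φ) × (∀ p → size (L ∘ Inverse.to φ) p ≡ size L p)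
shaped-pullback G H L H-shaped (φ , iso) =
  (λ i j i≢j → trans (sym (iso i j)) (H-shaped (Inverse.to φ i) (Inverse.to φ j) (i≢j ∘ Injection.injective (↔⇒↣ φ)))) ,
  (λ p → sym (∑-permute (λ i → 𝟙 (does (L i ≟ p))) φ))

∑-size : ∀ {n} (L : Fin n → Part) → ∑[ p < 4 ] size L p ≡ n
∑-size {n} L = begin
  ∑[ p < 4 ] ∑[ i < n ] 𝟙 (does (L i ≟ p))
    ≡⟨ ∑-comm (λ p i → 𝟙 (does (L i ≟ p))) ⟩
  ∑[ i < n ] ∑[ p < 4 ] 𝟙 (does (L i ≟ p))
    ≡⟨ sum-cong-≗ (λ i → trans (sum-cong-≗ {4} (λ p → sym (*-identityˡ (𝟙 (does (L i ≟ p))))))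
                               (∑-δ (L i) (λ _ → 1))) ⟩
  ∑[ i < n ] 1
    ≡⟨ ∑-const-1 n ⟩
  n ∎
  where open ≡-Reasoning

sizes : ℕ → ℕ → ℕ → ℕ → Part → ℕ
sizes u a t s U  = u
sizes u a t s X  = a
sizes u a t s Y₁ = t
sizes u a t s Y₂ = s

-- F₁ (suc K): vertex 0 is U, the vertices 1 … K are X, vertex K+1 is Y₁;
-- F₂ (suc K) has in addition the vertex K+2 in Y₂.
chain₁ : ∀ K → Fin (suc K) → Part
chain₁ zero    zero    = Y₁
chain₁ (suc K) zero    = X
chain₁ (suc K) (suc i) = chain₁ K i

chain₂ : ∀ K → Fin (suc (suc K)) → Part
chain₂ zero    zero       = Y₁
chain₂ zero    (suc zero) = Y₂
chain₂ (suc K) zero       = X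
chain₂ (suc K) (suc i)    = chain₂ K i

F₁-parts : ∀ K → Fin (suc (suc K)) → Part
F₁-parts K zero    = U
F₁-parts K (suc i) = chain₁ K i

F₂-parts : ∀ K → Fin (suc (suc (suc K))) → Part
F₂-parts K zero    = U
F₂-parts K (suc i) = chain₂ K i

chain₁≡chain₂∘inject₁ : ∀ K i → chain₁ K i ≡ chain₂ K (inject₁ i)
chain₁≡chain₂∘inject₁ zero    zero    = refl
chain₁≡chain₂∘inject₁ (suc K) zero    = refl
chain₁≡chain₂∘inject₁ (suc K) (suc i) = chain₁≡chain₂∘inject₁ K i

size-chain₁ : ∀ K q → size (chain₁ K) q ≡ sizes 0 K 1 0 q
size-chain₁ zero    U  = refl
size-chain₁ zero    X  = refl
size-chain₁ zero    Y₁ = refl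
size-chain₁ zero    Y₂ = refl
size-chain₁ (suc K) U  = size-chain₁ K U
size-chain₁ (suc K) X  = cong suc (size-chain₁ K X)
size-chain₁ (suc K) Y₁ = size-chain₁ K Y₁
size-chain₁ (suc K) Y₂ = size-chain₁ K Y₂

size-chain₂ : ∀ K q → size (chain₂ K) q ≡ sizes 0 K 1 1 q
size-chain₂ zero    U  = refl
size-chain₂ zero    X  = refl
size-chain₂ zero    Y₁ = refl
size-chain₂ zero    Y₂ = refl
size-chain₂ (suc K) U  = size-chain₂ K U
size-chain₂ (suc K) X  = cong suc (size-chain₂ K X)
size-chain₂ (suc K) Y₁ = size-chain₂ K Y₁
size-chain₂ (suc K) Y₂ = size-chain₂ K Y₂

size-F₁-parts : ∀ K q → size (F₁-parts K) q ≡ sizes 1 K 1 0 q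
size-F₁-parts K U  = cong suc (size-chain₁ K U)
size-F₁-parts K X  = size-chain₁ K X
size-F₁-parts K Y₁ = size-chain₁ K Y₁
size-F₁-parts K Y₂ = size-chain₁ K Y₂

size-F₂-parts : ∀ K q → size (F₂-parts K) q ≡ sizes 1 K 1 1 q
size-F₂-parts K U  = cong suc (size-chain₂ K U)
size-F₂-parts K X  = size-chain₂ K X
size-F₂-parts K Y₁ = size-chain₂ K Y₁
size-F₂-parts K Y₂ = size-chain₂ K Y₂

chain₂≢U : ∀ K i → chain₂ K i ≢ U
chain₂≢U zero    zero       ()
chain₂≢U zero    (suc zero) ()
chain₂≢U (suc K) zero       ()
chain₂≢U (suc K) (suc i)    = chain₂≢U K i

chain₂-unique : ∀ K i j → i ≢ j → chain₂ K i ≡ chain₂ K j → chain₂ K i ≡ X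
chain₂-unique zero    zero       zero       i≢j _  = contradiction refl i≢j
chain₂-unique zero    zero       (suc zero) _   ()
chain₂-unique zero    (suc zero) zero       _   ()
chain₂-unique zero    (suc zero) (suc zero) i≢j _  = contradiction refl i≢j
chain₂-unique (suc K) zero       j          _   _  = refl
chain₂-unique (suc K) (suc i)    zero       _   eq = eq
chain₂-unique (suc K) (suc i)    (suc j)    i≢j eq = chain₂-unique K i j (i≢j ∘ cong suc) eq

F₂-parts-unique : ∀ K i j → i ≢ j → F₂-parts K i ≡ F₂-parts K j → F₂-parts K i ≡ X
F₂-parts-unique K zero    zero    i≢j _  = contradiction refl i≢j
F₂-parts-unique K zero    (suc j) _   eq = contradiction (sym eq) (chain₂≢U K j)
F₂-parts-unique K (suc i) zero    _   eq = contradiction eq (chain₂≢U K i)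
F₂-parts-unique K (suc i) (suc j) i≢j eq = chain₂-unique K i j (i≢j ∘ cong suc) eq

-- The four Boolean tests on the position a of a vertex in the definition of F₂ (suc K):
-- a = 0, a < K + 1, a = K + 1, a = K + 2.
Signature : Set
Signature = Bool × Bool × Bool × Bool

signature : Part → Signature
signature U  = true  , true  , false , false
signature X  = false , true  , false , false
signature Y₁ = false , false , true  , false
signature Y₂ = false , false , false , true

F₂-formula : Bool → Signature → Signature → Bool
F₂-formula same (z₁ , c₁ , l₁ , m₁) (z₂ , c₂ , l₂ , m₂) =
  not same ∧ ((c₁ ∧ c₂) ∨ (((z₁ ∧ l₂) ∨ (l₁ ∧ m₂)) ∨ ((z₂ ∧ l₁) ∨ (l₂ ∧ m₁))))

F₂-formula-joined : ∀ p q → (p ≡ q → p ≡ X) → F₂-formula false (signature p) (signature q) ≡ joined p q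
F₂-formula-joined = toWitness {a? = all? λ p → all? λ q →
  ((p ≟ q) →-dec (p ≟ X)) →-dec (F₂-formula false (signature p) (signature q) ≟ᵇ joined p q)} _

chain₂-signature : ∀ K i → (false , (toℕ i <ᵇ K) , (toℕ i ≡ᵇ K) , (toℕ i ≡ᵇ suc K)) ≡ signature (chain₂ K i)
chain₂-signature zero    zero       = refl
chain₂-signature zero    (suc zero) = refl
chain₂-signature (suc K) zero       = refl
chain₂-signature (suc K) (suc i)    = chain₂-signature K i

F₂-signature : ∀ K (i : Fin (suc (suc (suc K)))) →
  ((toℕ i ≡ᵇ 0) , (toℕ i <ᵇ suc K) , (toℕ i ≡ᵇ suc K) , (toℕ i ≡ᵇ suc (suc K))) ≡ signature (F₂-parts K i)
F₂-signature K zero    = refl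
F₂-signature K (suc i) = chain₂-signature K i

F₂-shaped : ∀ K → Shaped (F₂ (suc K)) (F₂-parts K)
F₂-shaped K i j i≢j = begin
  F₂ (suc K) i j
    ≡⟨ cong₂ (F₂-formula (toℕ i ≡ᵇ toℕ j)) (F₂-signature K i) (F₂-signature K j) ⟩
  F₂-formula (toℕ i ≡ᵇ toℕ j) (signature p) (signature q)
    ≡⟨ cong (λ b → F₂-formula b (signature p) (signature q)) (dec-false (toℕ i ≟ℕ toℕ j) (i≢j ∘ toℕ-injective)) ⟩
  F₂-formula false (signature p) (signature q)
    ≡⟨ F₂-formula-joined p q (F₂-parts-unique K i j i≢j) ⟩
  joined p q ∎
  where
  open ≡-Reasoning
  p = F₂-parts K i
  q = F₂-parts K j

F₁-parts≡F₂-parts∘inject₁ : ∀ K i → F₁-parts K i ≡ F₂-parts K (inject₁ i)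
F₁-parts≡F₂-parts∘inject₁ K zero    = refl
F₁-parts≡F₂-parts∘inject₁ K (suc i) = chain₁≡chain₂∘inject₁ K i

F₁≡F₂∘inject₁ : ∀ k (i j : Fin (suc k)) → F₁ k i j ≡ F₂ k (inject₁ i) (inject₁ j)
F₁≡F₂∘inject₁ k i j
  rewrite toℕ-inject₁ i | toℕ-inject₁ j
        | dec-false (toℕ i ≟ℕ suc k) (<⇒≢ (toℕ<n i)) | dec-false (toℕ j ≟ℕ suc k) (<⇒≢ (toℕ<n j))
        | ∧-zeroʳ (toℕ i ≡ᵇ k) | ∧-zeroʳ (toℕ j ≡ᵇ k)
        | ∨-identityʳ ((toℕ i ≡ᵇ 0) ∧ (toℕ j ≡ᵇ k)) | ∨-identityʳ ((toℕ j ≡ᵇ 0) ∧ (toℕ i ≡ᵇ k)) = refl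

F₁-shaped : ∀ K → Shaped (F₁ (suc K)) (F₁-parts K)
F₁-shaped K i j i≢j = begin
  F₁ (suc K) i j
    ≡⟨ F₁≡F₂∘inject₁ (suc K) i j ⟩
  F₂ (suc K) (inject₁ i) (inject₁ j)
    ≡⟨ F₂-shaped K (inject₁ i) (inject₁ j) (i≢j ∘ inject₁-injective) ⟩
  joined (F₂-parts K (inject₁ i)) (F₂-parts K (inject₁ j))
    ≡⟨ sym (cong₂ joined (F₁-parts≡F₂-parts∘inject₁ K i) (F₁-parts≡F₂-parts∘inject₁ K j)) ⟩
  joined (F₁-parts K i) (F₁-parts K j) ∎
  where open ≡-Reasoning

F₁-irrefl : ∀ k (i : Fin (suc k)) → F₁ k i i ≡ false
F₁-irrefl k i rewrite dec-true (toℕ i ≟ℕ toℕ i) refl = refl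

F₂-irrefl : ∀ k (i : Fin (suc (suc k))) → F₂ k i i ≡ false
F₂-irrefl k i rewrite dec-true (toℕ i ≟ℕ toℕ i) refl = refl

-- Graphs with a cut vertex and independence number 2

module _ {n} {G : Graph n} {P : Fin n → Set} where

  walk-++ : ∀ {a b c} → WalkIn G P a b → WalkIn G P b c → WalkIn G P a c
  walk-++ (here _)       q = q
  walk-++ (step pa e p) q = step pa e (walk-++ p q)

  walk-start : ∀ {a b} → WalkIn G P a b → P a
  walk-start (here pa)     = pa
  walk-start (step pa _ _) = pa

  walk-reverse : ∀ {a b} → WalkIn G P a b → WalkIn G P b a
  walk-reverse (here pa)     = here pa
  walk-reverse (step pa e p) = walk-++ (walk-reverse p) (step (walk-start p) (trans (Graph.sym G _ _) e) (here pa))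

walk-invariant : ∀ {n} (G : Graph n) (S : Fin n → Set) → (∀ {a b} → S a → Adj G a b → S b) →
                 ∀ {a b} → WalkIn G Everything a b → S a → S b
walk-invariant G S closed (here _)      Sa = Sa
walk-invariant G S closed (step _ e p) Sa = walk-invariant G S closed p (closed Sa e)

independent-triple : ∀ {n} (G : Graph n) p q r → p ≢ q → p ≢ r → q ≢ r →
  adj G p q ≡ false → adj G p r ≡ false → adj G q r ≡ false → HasIndependentSet G 3
independent-triple G p q r p≢q p≢r q≢r pq pr qr = f , injective , independent
  where
  f : Fin 3 → _
  f zero             = p
  f (suc zero)       = q
  f (suc (suc zero)) = r
  injective : ∀ {a b} → f a ≡ f b → a ≡ b
  injective {zero}             {zero}             _ = refl
  injective {zero}             {suc zero}         e = contradiction e p≢q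
  injective {zero}             {suc (suc zero)}   e = contradiction e p≢r
  injective {suc zero}         {zero}             e = contradiction (sym e) p≢q
  injective {suc zero}         {suc zero}         _ = refl
  injective {suc zero}         {suc (suc zero)}   e = contradiction e q≢r
  injective {suc (suc zero)}   {zero}             e = contradiction (sym e) p≢r
  injective {suc (suc zero)}   {suc zero}         e = contradiction (sym e) q≢r
  injective {suc (suc zero)}   {suc (suc zero)}   _ = refl
  independent : ∀ a b → adj G (f a) (f b) ≡ false
  independent zero             zero             = irrefl G p
  independent zero             (suc zero)       = pq
  independent zero             (suc (suc zero)) = pr
  independent (suc zero)       zero             = trans (Graph.sym G q p) pq
  independent (suc zero)       (suc zero)       = irrefl G q
  independent (suc zero)       (suc (suc zero)) = qr
  independent (suc (suc zero)) zero             = trans (Graph.sym G r p) pr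
  independent (suc (suc zero)) (suc zero)       = trans (Graph.sym G r q) qr
  independent (suc (suc zero)) (suc (suc zero)) = irrefl G r

Near : ∀ {n} → Graph n → Fin n → Fin n → Set
Near G c z = z ≡ c ⊎ Adj G c z

near? : ∀ {n} (G : Graph n) c z → Dec (Near G c z)
near? G c z = (z ≟ c) ⊎-dec (adj G c z ≟ᵇ true)

module Sides {n} (G : Graph n) (u v w : Fin n) (v≢u : v ≢ u) (w≢u : w ≢ u)
  (separated : ¬ WalkIn G (λ z → z ≢ u) v w) (no-triple : ¬ HasIndependentSet G 3) where

  walk-from-v : ∀ {z} → z ≢ u → Near G v z → WalkIn G (λ z → z ≢ u) v z
  walk-from-v z≢u (inj₁ refl) = here z≢u
  walk-from-v z≢u (inj₂ e)    = step v≢u e (here z≢u)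

  walk-to-w : ∀ {z} → z ≢ u → Near G w z → WalkIn G (λ z → z ≢ u) z w
  walk-to-w z≢u (inj₁ refl) = here z≢u
  walk-to-w z≢u (inj₂ e)    = step z≢u (trans (Graph.sym G _ w) e) (here w≢u)

  near-disjoint : ∀ {z} → z ≢ u → Near G v z → ¬ Near G w z
  near-disjoint z≢u nv nw = separated (walk-++ (walk-from-v z≢u nv) (walk-to-w z≢u nw))

  no-edge-across : ∀ {z z′} → z ≢ u → z′ ≢ u → Near G v z → Near G w z′ → adj G z z′ ≡ false
  no-edge-across z≢u z′≢u nv nw = ¬-not λ e → separated (walk-++ (walk-from-v z≢u nv) (step z≢u e (walk-to-w z′≢u nw)))

  v≢w : v ≢ w
  v≢w v≡w = near-disjoint v≢u (inj₁ refl) (inj₁ v≡w)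

  near-cover : ∀ {z} → z ≢ u → ¬ Near G v z → Near G w z
  near-cover {z} z≢u ¬nv with near? G w z
  ... | yes nw = nw
  ... | no ¬nw = contradiction
    (independent-triple G v w z v≢w (¬nv ∘ inj₁ ∘ sym) (¬nw ∘ inj₁ ∘ sym)
       (no-edge-across v≢u w≢u (inj₁ refl) (inj₁ refl)) (¬-not (¬nv ∘ inj₂)) (¬-not (¬nw ∘ inj₂)))
    no-triple

  near-clique : ∀ {z z′} → z ≢ z′ → z ≢ u → z′ ≢ u → Near G v z → Near G v z′ → adj G z z′ ≡ true
  near-clique {z} {z′} z≢z′ z≢u z′≢u nv nv′ = ¬-not {y = false} λ e → no-triple
    (independent-triple G z z′ w z≢z′ (near-disjoint z≢u nv ∘ inj₁) (near-disjoint z′≢u nv′ ∘ inj₁) e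
       (no-edge-across z≢u w≢u nv (inj₁ refl)) (no-edge-across z′≢u w≢u nv′ (inj₁ refl)))

record CutShape {n} (G : Graph n) : Set where
  field
    part        : Fin n → Part
    shaped      : Shaped (adj G) part
    U-singleton : size part U ≡ 1
    X-nonempty  : 1 ≤ size part X
    Y₁-nonempty : 1 ≤ size part Y₁

module Decomposition {n} (G : Graph n) (u v w : Fin n) (v≢u : v ≢ u) (w≢u : w ≢ u)
  (separated : ¬ WalkIn G (λ z → z ≢ u) v w) (no-triple : ¬ HasIndependentSet G 3)
  (connected : Connected G) (u-complete : ∀ z → z ≢ u → Near G v z → Adj G u z) where

  open Sides G u v w v≢u w≢u separated no-triple
  module Far = Sides G u w v w≢u v≢u (separated ∘ walk-reverse) no-triple

  data Place (z : Fin n) : Set where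
    at-u  : z ≡ u → Place z
    in-X  : z ≢ u → Near G v z → Place z
    in-Y₁ : z ≢ u → ¬ Near G v z → Adj G u z → Place z
    in-Y₂ : z ≢ u → ¬ Near G v z → adj G u z ≡ false → Place z

  place : ∀ z → Place z
  place z with z ≟ u | near? G v z | adj G u z in e
  ... | yes z≡u | _      | _     = at-u z≡u
  ... | no  z≢u | yes nv | _     = in-X z≢u nv
  ... | no  z≢u | no ¬nv | true  = in-Y₁ z≢u ¬nv e
  ... | no  z≢u | no ¬nv | false = in-Y₂ z≢u ¬nv e

  part-of : ∀ {z} → Place z → Part
  part-of (at-u _)      = U
  part-of (in-X _ _)    = X
  part-of (in-Y₁ _ _ _) = Y₁
  part-of (in-Y₂ _ _ _) = Y₂

  part : Fin n → Part
  part z = part-of (place z)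

  far-clique : ∀ {i j} → i ≢ j → i ≢ u → j ≢ u → ¬ Near G v i → ¬ Near G v j → adj G i j ≡ true
  far-clique i≢j i≢u j≢u ¬nv ¬nv′ = Far.near-clique i≢j i≢u j≢u (near-cover i≢u ¬nv) (near-cover j≢u ¬nv′)

  adj-places : ∀ {i j} → i ≢ j → (pᵢ : Place i) (pⱼ : Place j) → adj G i j ≡ joined (part-of pᵢ) (part-of pⱼ)
  adj-places i≢j (at-u refl)       (at-u refl)       = contradiction refl i≢j
  adj-places _   (at-u refl)       (in-X j≢u nv)     = u-complete _ j≢u nv
  adj-places _   (at-u refl)       (in-Y₁ _ _ e)     = e
  adj-places _   (at-u refl)       (in-Y₂ _ _ e)     = e
  adj-places _   (in-X i≢u nv)     (at-u refl)       = trans (Graph.sym G _ u) (u-complete _ i≢u nv)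
  adj-places _   (in-Y₁ _ _ e)     (at-u refl)       = trans (Graph.sym G _ u) e
  adj-places _   (in-Y₂ _ _ e)     (at-u refl)       = trans (Graph.sym G _ u) e
  adj-places i≢j (in-X i≢u nv)     (in-X j≢u nv′)    = near-clique i≢j i≢u j≢u nv nv′
  adj-places _   (in-X i≢u nv)     (in-Y₁ j≢u ¬nv _) = no-edge-across i≢u j≢u nv (near-cover j≢u ¬nv)
  adj-places _   (in-X i≢u nv)     (in-Y₂ j≢u ¬nv _) = no-edge-across i≢u j≢u nv (near-cover j≢u ¬nv)
  adj-places _   (in-Y₁ i≢u ¬nv _) (in-X j≢u nv)     = trans (Graph.sym G _ _) (no-edge-across j≢u i≢u nv (near-cover i≢u ¬nv))
  adj-places _   (in-Y₂ i≢u ¬nv _) (in-X j≢u nv)     = trans (Graph.sym G _ _) (no-edge-across j≢u i≢u nv (near-cover i≢u ¬nv))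
  adj-places i≢j (in-Y₁ i≢u ¬nv _) (in-Y₁ j≢u ¬nv′ _) = far-clique i≢j i≢u j≢u ¬nv ¬nv′
  adj-places i≢j (in-Y₁ i≢u ¬nv _) (in-Y₂ j≢u ¬nv′ _) = far-clique i≢j i≢u j≢u ¬nv ¬nv′
  adj-places i≢j (in-Y₂ i≢u ¬nv _) (in-Y₁ j≢u ¬nv′ _) = far-clique i≢j i≢u j≢u ¬nv ¬nv′
  adj-places i≢j (in-Y₂ i≢u ¬nv _) (in-Y₂ j≢u ¬nv′ _) = far-clique i≢j i≢u j≢u ¬nv ¬nv′

  part-U⇔ : ∀ z → part z ≡ U ⇔ u ≡ z
  part-U⇔ z = mk⇔ (at-u-only (place z)) (λ { refl → u-at-u (place u) })
    where
    at-u-only : ∀ {z} (p : Place z) → part-of p ≡ U → u ≡ z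
    at-u-only (at-u z≡u) _ = sym z≡u
    u-at-u : (p : Place u) → part-of p ≡ U
    u-at-u (at-u _)          = refl
    u-at-u (in-X u≢u _)      = contradiction refl u≢u
    u-at-u (in-Y₁ u≢u _ _)   = contradiction refl u≢u
    u-at-u (in-Y₂ u≢u _ _)   = contradiction refl u≢u

  v-in-X : (p : Place v) → part-of p ≡ X
  v-in-X (at-u v≡u)       = contradiction v≡u v≢u
  v-in-X (in-X _ _)       = refl
  v-in-X (in-Y₁ _ ¬nv _)  = contradiction (inj₁ refl) ¬nv
  v-in-X (in-Y₂ _ ¬nv _)  = contradiction (inj₁ refl) ¬nv

  Y₁-part : ∀ {z} → z ≢ u → ¬ Near G v z → Adj G u z → part z ≡ Y₁
  Y₁-part {z} z≢u ¬nv e with place z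
  ... | at-u z≡u       = contradiction z≡u z≢u
  ... | in-X _ nv      = contradiction nv ¬nv
  ... | in-Y₁ _ _ _    = refl
  ... | in-Y₂ _ _ e′   = contradiction (trans (sym e) e′) λ ()

  -- Without Y₁-vertices, u together with the v-side would be closed under adjacency,
  -- and by connectivity would contain w.
  Y₁-occupied : ∃ λ z → part z ≡ Y₁
  Y₁-occupied with any? (λ z → part z ≟ Y₁)
  ... | yes found = found
  ... | no  none  = contradiction (walk-invariant G UorX closed (connected v w) (inj₂ (inj₁ refl))) w∉UorX
    where
    UorX : Fin n → Set
    UorX z = u ≡ z ⊎ Near G v z
    w∉UorX : ¬ UorX w
    w∉UorX (inj₁ u≡w) = w≢u (sym u≡w)
    w∉UorX (inj₂ nv)  = near-disjoint w≢u nv (inj₁ refl)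
    closed : ∀ {a b} → UorX a → Adj G a b → UorX b
    closed {a} {b} a∈ e with place b
    ... | at-u b≡u          = inj₁ (sym b≡u)
    ... | in-X _ nv         = inj₂ nv
    ... | in-Y₁ b≢u ¬nv e′  = contradiction (b , Y₁-part b≢u ¬nv e′) none
    ... | in-Y₂ b≢u ¬nv e′ with a ≟ u | a∈
    ...   | yes refl | _          = contradiction (trans (sym e) e′) λ ()
    ...   | no  a≢u  | inj₁ u≡a   = contradiction (sym u≡a) a≢u
    ...   | no  a≢u  | inj₂ nvₐ   = contradiction (trans (sym e) (no-edge-across a≢u b≢u nvₐ (near-cover b≢u ¬nv))) λ ()

  cut-shape : CutShape G
  cut-shape = record
    { part        = part
    ; shaped      = λ i j i≢j → adj-places i≢j (place i) (place j)
    ; U-singleton = trans (sum-cong-≗ λ z → trans (cong 𝟙 (does-⇔ (part-U⇔ z) (part z ≟ U) (u ≟ z))) (sym (*-identityˡ _)))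
                          (∑-δ u (λ _ → 1))
    ; X-nonempty  = subst (λ p → 1 ≤ size part p) (v-in-X (place v)) (size-≥1 part v)
    ; Y₁-nonempty = subst (λ p → 1 ≤ size part p) (proj₂ Y₁-occupied) (size-≥1 part (proj₁ Y₁-occupied))
    }

-- If u misses a vertex a on the v-side, it is joined to the whole w-side
-- (otherwise u, a and a non-neighbour on the w-side are independent); swap v and w.
cut-vertex-shape : ∀ {n} (G : Graph n) u → Connected G → IndependenceNumber G 2 → CutVertex G u → CutShape G
cut-vertex-shape G u connected (_ , maximal) (v , w , v≢u , w≢u , separated)
  with any? (λ a → ¬? (a ≟ u) ×-dec (near? G v a ×-dec ¬? (adj G u a ≟ᵇ true)))
... | no  none = Decomposition.cut-shape G u v w v≢u w≢u separated no-triple connected u-complete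
  where
  no-triple = maximal 3 (s≤s (s≤s (s≤s z≤n)))
  u-complete : ∀ z → z ≢ u → Near G v z → Adj G u z
  u-complete z z≢u nv = ¬-not {y = false} λ ¬e → none (z , z≢u , nv , λ e → contradiction (trans (sym ¬e) e) λ ())
... | yes (a , a≢u , nvₐ , ¬uₐ) = Decomposition.cut-shape G u w v w≢u v≢u separated′ no-triple connected u-complete
  where
  no-triple = maximal 3 (s≤s (s≤s (s≤s z≤n)))
  separated′ = separated ∘ walk-reverse
  open Sides G u v w v≢u w≢u separated no-triple
  u-complete : ∀ z → z ≢ u → Near G w z → Adj G u z
  u-complete z z≢u nw = ¬-not {y = false} λ ¬e → no-triple
    (independent-triple G u a z (a≢u ∘ sym) (z≢u ∘ sym) (λ a≡z → near-disjoint a≢u nvₐ (subst (Near G w) (sym a≡z) nw))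
       (¬-not ¬uₐ) ¬e (no-edge-across a≢u z≢u nvₐ nw))

-- The bound

-- π(G, y + 1) / (y + 1) for |X| = a, |Y₁| = t′ + 1, |Y₂| = s: the colourings with the colour of U fixed.
cutπ : ℕ → ℕ → ℕ → ℕ → ℕ
cutπ y a t′ s = y ↓ a * (y ↓ suc t′ * (y ∸ t′) ↓ s)

↓-suc-∸-↓ : ∀ y t′ s → y ↓ suc t′ * (y ∸ t′) ↓ s ≡ y ↓ (t′ + s) * (y ∸ t′)
↓-suc-∸-↓ y t′ s = begin
  y ↓ suc t′ * (y ∸ t′) ↓ s            ≡⟨ cong (_* (y ∸ t′) ↓ s) (↓-suc y t′) ⟩
  y ↓ t′ * (y ∸ t′) * (y ∸ t′) ↓ s     ≡⟨ swap-last (y ↓ t′) (y ∸ t′) ((y ∸ t′) ↓ s) ⟩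
  y ↓ t′ * (y ∸ t′) ↓ s * (y ∸ t′)     ≡⟨ cong (_* (y ∸ t′)) (sym (↓-+ y t′ s)) ⟩
  y ↓ (t′ + s) * (y ∸ t′)              ∎
  where
  open ≡-Reasoning
  swap-last : ∀ A c S → A * c * S ≡ A * S * c
  swap-last = solve-∀

-- The size vectors (a, t′, s) = (|X|, |Y₁| − 1, |Y₂|) attaining the bound for χ = K + 1:
-- F₁ and F₂ with clique U ∪ X, F₁ with clique U ∪ Y₁, and F₂ with clique Y₁ ∪ Y₂.
data Extremal : ℕ → ℕ → ℕ → ℕ → Set where
  pendant-edge      : ∀ {K}  → Extremal K K 0 0
  pendant-path      : ∀ {K}  → Extremal K K 0 1
  pendant-edge-at-Y : ∀ {t′} → Extremal (suc t′) 1 t′ 0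
  pendant-path-at-Y : ∀ {s}  → Extremal s 1 0 s

BoundWith : ℕ → ℕ → ℕ → ℕ → ℕ → ℕ → Set
BoundWith y a t′ s K e = cutπ y a t′ s ≤ y ↓ K * y ^ e × (cutπ y a t′ s ≡ y ↓ K * y ^ e → Extremal K a t′ s)

Bound : ℕ → ℕ → ℕ → ℕ → ℕ → Set
Bound y a t′ s K = BoundWith y a t′ s K (a + suc t′ + s ∸ K)

-- The three cases of the bound, according to which of the cliques U ∪ X, U ∪ Y₁, Y₁ ∪ Y₂
-- (of sizes a + 1, t′ + 2, t′ + 1 + s) is largest.
bound-UX-largest : ∀ {y a t′ s} → 1 ≤ a → t′ + s ≤ a → a ≤ y → Bound y a t′ s a
bound-UX-largest {y} {a} {t′} {s} 1≤a t′+s≤a a≤y =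
  subst (BoundWith y a t′ s a) (sym exponent) (bound , extremal ∘ equality)
  where
  exponent : a + suc t′ + s ∸ a ≡ suc t′ + s
  exponent = trans (cong (_∸ a) (+-assoc a (suc t′) s)) (m+n∸m≡n a (suc t′ + s))
  1≤y = ≤-trans 1≤a a≤y
  inner≤ : (y ∸ t′) ↓ s ≤ y ^ s
  inner≤ = ≤-trans (↓≤^ (y ∸ t′) s) (^-monoˡ-≤ s (m∸n≤m y t′))
  bound : cutπ y a t′ s ≤ y ↓ a * y ^ (suc t′ + s)
  bound = *-monoʳ-≤ (y ↓ a) (≤-trans (*-mono-≤ (↓≤^ y (suc t′)) inner≤) (≤-reflexive (sym (^-distribˡ-+-* y (suc t′) s))))
  equality : cutπ y a t′ s ≡ y ↓ a * y ^ (suc t′ + s) → t′ ≡ 0 × s ≤ 1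
  equality eq with *-≤-tight (↓≤^ y (suc t′)) inner≤ (↓-positive (m+n≤o⇒n≤o∸m t′ (≤-trans t′+s≤a a≤y)))
                             (m^n>0 y {{>-nonZero 1≤y}} (suc t′))
                    (trans (*-cancelˡ-≡ _ _ (y ↓ a) {{>-nonZero (↓-positive a≤y)}} eq) (^-distribˡ-+-* y (suc t′) s))
  ... | ↓t≡^t , ↓s≡^s with ↓≡^⇒≤1 (suc t′) 1≤y ↓t≡^t
  ...   | s≤s z≤n = refl , ↓≡^⇒≤1 s 1≤y ↓s≡^s
  extremal : t′ ≡ 0 × s ≤ 1 → Extremal a a t′ s
  extremal (refl , z≤n)     = pendant-edge
  extremal (refl , s≤s z≤n) = pendant-path

bound-Y-largest : ∀ {y a t′ s} → 1 ≤ a → a ≤ t′ + s → suc t′ ≤ t′ + s → t′ + s ≤ y → Bound y a t′ s (t′ + s)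
bound-Y-largest {y} {a} {t′} {s} 1≤a a≤t′+s t′<t′+s t′+s≤y =
  subst (BoundWith y a t′ s (t′ + s)) (sym exponent) (bound , extremal ∘ equality)
  where
  exponent : a + suc t′ + s ∸ (t′ + s) ≡ suc a
  exponent = trans (cong (_∸ (t′ + s)) (shuffle a t′ s)) (m+n∸m≡n (t′ + s) (suc a))
    where
    shuffle : ∀ a t′ s → a + suc t′ + s ≡ t′ + s + suc a
    shuffle = solve-∀
  1≤y = ≤-trans 1≤a (≤-trans a≤t′+s t′+s≤y)
  regroup : cutπ y a t′ s ≡ y ↓ (t′ + s) * (y ↓ a * (y ∸ t′))
  regroup = trans (cong (y ↓ a *_) (↓-suc-∸-↓ y t′ s)) (swap (y ↓ a) (y ↓ (t′ + s)) (y ∸ t′))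
    where
    swap : ∀ A B c → A * (B * c) ≡ B * (A * c)
    swap = solve-∀
  inner≤ : y ↓ a * (y ∸ t′) ≤ y ^ suc a
  inner≤ = ≤-trans (*-mono-≤ (↓≤^ y a) (m∸n≤m y t′)) (≤-reflexive (*-comm (y ^ a) y))
  bound : cutπ y a t′ s ≤ y ↓ (t′ + s) * y ^ suc a
  bound = ≤-trans (≤-reflexive regroup) (*-monoʳ-≤ (y ↓ (t′ + s)) inner≤)
  equality : cutπ y a t′ s ≡ y ↓ (t′ + s) * y ^ suc a → a ≡ 1 × t′ ≡ 0
  equality eq with *-≤-tight (↓≤^ y a) (m∸n≤m y t′) (m<n⇒0<n∸m (≤-trans t′<t′+s t′+s≤y)) (m^n>0 y {{>-nonZero 1≤y}} a)
                    (trans (*-cancelˡ-≡ _ _ (y ↓ (t′ + s)) {{>-nonZero (↓-positive t′+s≤y)}} (trans (sym regroup) eq))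
                           (*-comm y (y ^ a)))
  ... | ↓a≡^a , y∸t′≡y = ≤-antisym (↓≡^⇒≤1 a 1≤y ↓a≡^a) 1≤a , ∸≡⇒≡0 t′ 1≤y y∸t′≡y
  extremal : a ≡ 1 × t′ ≡ 0 → Extremal (t′ + s) a t′ s
  extremal (refl , refl) = pendant-path-at-Y

bound-UY₁-largest-Y₂-empty : ∀ {y a t′} → 1 ≤ a → a ≤ suc t′ → suc t′ ≤ y → Bound y a t′ 0 (suc t′)
bound-UY₁-largest-Y₂-empty {y} {a} {t′} 1≤a a≤t t≤y =
  subst (BoundWith y a t′ 0 (suc t′)) (sym exponent) (bound , extremal ∘ equality)
  where
  exponent : a + suc t′ + 0 ∸ suc t′ ≡ a
  exponent = trans (cong (_∸ suc t′) (+-identityʳ (a + suc t′))) (m+n∸n≡m a (suc t′))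
  1≤y = ≤-trans 1≤a (≤-trans a≤t t≤y)
  rhs : y ↓ suc t′ * y ^ a ≡ y ^ a * (y ↓ suc t′ * 1)
  rhs = trans (*-comm (y ↓ suc t′) (y ^ a)) (cong (y ^ a *_) (sym (*-identityʳ _)))
  bound : cutπ y a t′ 0 ≤ y ↓ suc t′ * y ^ a
  bound = ≤-trans (*-monoˡ-≤ (y ↓ suc t′ * 1) (↓≤^ y a)) (≤-reflexive (sym rhs))
  equality : cutπ y a t′ 0 ≡ y ↓ suc t′ * y ^ a → a ≡ 1
  equality eq = ≤-antisym (↓≡^⇒≤1 a 1≤y (proj₁ (*-≤-tight (↓≤^ y a) ≤-refl
                  (subst (0 <_) (sym (*-identityʳ _)) (↓-positive t≤y)) (m^n>0 y {{>-nonZero 1≤y}} a) (trans eq rhs)))) 1≤a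
  extremal : a ≡ 1 → Extremal (suc t′) a t′ 0
  extremal refl = pendant-edge-at-Y

bound-UY₁-largest : ∀ {y a t′ s} → 1 ≤ a → a ≤ suc t′ → t′ + s ≤ suc t′ → suc t′ ≤ y → Bound y a t′ s (suc t′)
bound-UY₁-largest {s = zero}  1≤a a≤t _ t≤y = bound-UY₁-largest-Y₂-empty 1≤a a≤t t≤y
bound-UY₁-largest {y} {a} {t′} {suc zero} 1≤a a≤t _ t≤y =
  subst (Bound y a t′ 1) t+1≡t
    (bound-Y-largest 1≤a (subst (a ≤_) (sym t+1≡t) a≤t) (≤-reflexive (sym t+1≡t)) (subst (_≤ y) (sym t+1≡t) t≤y))
  where
  t+1≡t = +-comm t′ 1
bound-UY₁-largest {t′ = t′} {suc (suc s)} _ _ t+s≤t _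
  with +-cancelˡ-≤ t′ (suc (suc s)) 1 (subst (t′ + suc (suc s) ≤_) (+-comm 1 t′) t+s≤t)
... | s≤s ()

largest-clique-bounds : ∀ a t′ s → let K = a ⊔ (suc t′ ⊔ (t′ + s)) in a ≤ K × suc t′ ≤ K × t′ + s ≤ K
largest-clique-bounds a t′ s =
  m≤m⊔n a _ , ≤-trans (m≤m⊔n (suc t′) (t′ + s)) (m≤n⊔m a _) , ≤-trans (m≤n⊔m (suc t′) (t′ + s)) (m≤n⊔m a _)

module _ {y a t′ s : ℕ} (1≤a : 1 ≤ a) (K≤y : a ⊔ (suc t′ ⊔ (t′ + s)) ≤ y) where

  private
    a≤K = proj₁ (largest-clique-bounds a t′ s)
    t<K = proj₁ (proj₂ (largest-clique-bounds a t′ s))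
    t+s≤K = proj₂ (proj₂ (largest-clique-bounds a t′ s))

  cutπ-bound : Bound y a t′ s (a ⊔ (suc t′ ⊔ (t′ + s)))
  cutπ-bound with ⊔-sel a (suc t′ ⊔ (t′ + s)) | ⊔-sel (suc t′) (t′ + s)
  ... | inj₁ K≡a | _ = subst (Bound y a t′ s) (sym K≡a)
    (bound-UX-largest 1≤a (subst (t′ + s ≤_) K≡a t+s≤K) (subst (_≤ y) K≡a K≤y))
  ... | inj₂ K≡Y | inj₂ Y≡Y₂ = subst (Bound y a t′ s) (sym K≡Y₂)
    (bound-Y-largest 1≤a (subst (a ≤_) K≡Y₂ a≤K) (subst (suc t′ ≤_) K≡Y₂ t<K) (subst (_≤ y) K≡Y₂ K≤y))
    where K≡Y₂ = trans K≡Y Y≡Y₂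
  ... | inj₂ K≡Y | inj₁ Y≡Y₁ = subst (Bound y a t′ s) (sym K≡Y₁)
    (bound-UY₁-largest 1≤a (subst (a ≤_) K≡Y₁ a≤K) (subst (t′ + s ≤_) K≡Y₁ t+s≤K) (subst (_≤ y) K≡Y₁ K≤y))
    where K≡Y₁ = trans K≡Y Y≡Y₁

cutπ-positive⇔ : ∀ y a t′ s → 0 < cutπ y a t′ s ⇔ a ⊔ (suc t′ ⊔ (t′ + s)) ≤ y
cutπ-positive⇔ y a t′ s = mk⇔ to from
  where
  to : 0 < cutπ y a t′ s → a ⊔ (suc t′ ⊔ (t′ + s)) ≤ y
  to pos = ⊔-lub (↓-positive⇒≤ y a (positive-*ˡ _ _ pos)) (⊔-lub t<y t+s≤y)
    where
    rest = positive-*ʳ (y ↓ a) _ pos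
    t<y = ↓-positive⇒≤ y (suc t′) (positive-*ˡ _ _ rest)
    t+s≤y = subst (_≤ y) (+-comm s t′)
              (m≤o∸n⇒m+n≤o s (≤-trans (n≤1+n t′) t<y) (↓-positive⇒≤ (y ∸ t′) s (positive-*ʳ (y ↓ suc t′) _ rest)))
  from : a ⊔ (suc t′ ⊔ (t′ + s)) ≤ y → 0 < cutπ y a t′ s
  from K≤y = let a≤K , t<K , t+s≤K = largest-clique-bounds a t′ s in
    *-positive (↓-positive (≤-trans a≤K K≤y))
               (*-positive (↓-positive (≤-trans t<K K≤y)) (↓-positive (m+n≤o⇒n≤o∸m t′ (≤-trans t+s≤K K≤y))))

module _ {n} {G : Graph n} {L : Fin n → Part} (shaped : Shaped (adj G) L)
         {a t′ s : ℕ} (sized : ∀ p → size L p ≡ sizes 1 a (suc t′) s p) where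

  π-cut : ∀ y → π G (suc y) ≡ suc y * cutπ y a t′ s
  π-cut y = trans (π-shaped G L shaped (suc y)) (trans (shapeπ-cong (suc y) sized) (cong (_* cutπ y a t′ s) (*-identityʳ (suc y))))

  order : n ≡ suc (a + suc t′ + s)
  order = trans (sym (∑-size L)) (trans (sum-cong-≗ {4} sized) (regroup a t′ s))
    where
    regroup : ∀ a t′ s → 1 + (a + (suc t′ + (s + 0))) ≡ suc (a + suc t′ + s)
    regroup = solve-∀

  colourable⇔ : ∀ y → Colourable G (suc y) ⇔ a ⊔ (suc t′ ⊔ (t′ + s)) ≤ y
  colourable⇔ y = mk⇔
    (λ col → Equivalence.to (cutπ-positive⇔ y a t′ s)
               (positive-*ʳ (suc y) (cutπ y a t′ s) (subst (0 <_) (π-cut y) (colourable⇒π-positive G (suc y) col))))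
    (λ K≤y → π-positive⇒colourable G (suc y)
               (subst (0 <_) (sym (π-cut y)) (*-positive {suc y} (s≤s z≤n) (Equivalence.from (cutπ-positive⇔ y a t′ s) K≤y))))

  χ-shaped : ∀ {K} → ChromaticNumber G (suc K) → K ≡ a ⊔ (suc t′ ⊔ (t′ + s))
  χ-shaped {K} (col , minimal) = ≤-antisym K≤max (Equivalence.to (colourable⇔ K) col)
    where
    K≤max : K ≤ a ⊔ (suc t′ ⊔ (t′ + s))
    K≤max with a ⊔ (suc t′ ⊔ (t′ + s)) <? K
    ... | yes max<K = contradiction (Equivalence.from (colourable⇔ _) ≤-refl) (minimal _ (s≤s max<K))
    ... | no  max≮K = ≮⇒≥ max≮K

-- The extremal graphs

-- Two relabellings of the parts exhibiting the remaining extremal graphs as F₁ and F₂: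
-- τ makes the vertex of Y₁ the cut vertex (for the path X – U – Y₁ hanging off the clique Y),
-- σ exchanges X and Y₁ (when Y₂ is empty).
τ : Part → Part
τ U  = Y₁
τ X  = Y₂
τ Y₁ = U
τ Y₂ = X

σ : Part → Part
σ U  = U
σ X  = Y₁
σ Y₁ = X
σ Y₂ = Y₂

τ-involutive : ∀ p → τ (τ p) ≡ p
τ-involutive U = refl ; τ-involutive X = refl ; τ-involutive Y₁ = refl ; τ-involutive Y₂ = refl

σ-involutive : ∀ p → σ (σ p) ≡ p
σ-involutive U = refl ; σ-involutive X = refl ; σ-involutive Y₁ = refl ; σ-involutive Y₂ = refl

τ-joined : ∀ p q → joined (τ p) (τ q) ≡ joined p q
τ-joined = toWitness {a? = all? λ p → all? λ q → joined (τ p) (τ q) ≟ᵇ joined p q} _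

σ-joined : ∀ p q → p ≢ Y₂ → q ≢ Y₂ → joined (σ p) (σ q) ≡ joined p q
σ-joined = toWitness {a? = all? λ p → all? λ q →
  ¬? (p ≟ Y₂) →-dec (¬? (q ≟ Y₂) →-dec (joined (σ p) (σ q) ≟ᵇ joined p q))} _

size-relabel : ∀ {n} (ρ : Part → Part) → (∀ p → ρ (ρ p) ≡ p) → (L : Fin n → Part) → ∀ q → size (ρ ∘ L) q ≡ size L (ρ q)
size-relabel ρ involutive L q = sum-cong-≗ λ i → cong 𝟙 (does-⇔ (ρ-adjoint (L i)) (ρ (L i) ≟ q) (L i ≟ ρ q))
  where
  ρ-adjoint : ∀ p → ρ p ≡ q ⇔ p ≡ ρ q
  ρ-adjoint p = mk⇔ (λ eq → trans (sym (involutive p)) (cong ρ eq)) (λ eq → trans (cong ρ eq) (involutive q))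

extremal-iso : ∀ {n} (G : Graph n) (L : Fin n → Part) → Shaped (adj G) L →
  ∀ {K a t′ s} → (∀ p → size L p ≡ sizes 1 a (suc t′) s p) → Extremal K a t′ s → IsoTo G (F₁ (suc K)) ⊎ IsoTo G (F₂ (suc K))
extremal-iso G L shaped {K} sized pendant-edge = inj₁
  (shaped-iso G (F₁ (suc K)) L (F₁-parts K) shaped (F₁-irrefl (suc K)) (F₁-shaped K) λ p → trans (sized p) (sym (size-F₁-parts K p)))
extremal-iso G L shaped {K} sized pendant-path = inj₂
  (shaped-iso G (F₂ (suc K)) L (F₂-parts K) shaped (F₂-irrefl (suc K)) (F₂-shaped K) λ p → trans (sized p) (sym (size-F₂-parts K p)))
extremal-iso G L shaped {K} sized pendant-edge-at-Y =
  inj₁ (shaped-iso G (F₁ (suc K)) (σ ∘ L) (F₁-parts K) σ-shaped (F₁-irrefl (suc K)) (F₁-shaped K) sizes-σ)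
  where
  no-Y₂ : ∀ i → L i ≢ Y₂
  no-Y₂ i Li≡Y₂ = contradiction (subst (1 ≤_) (sized Y₂) (subst (λ p → 1 ≤ size L p) Li≡Y₂ (size-≥1 L i))) λ ()
  σ-shaped : Shaped (adj G) (σ ∘ L)
  σ-shaped i j i≢j = trans (shaped i j i≢j) (sym (σ-joined (L i) (L j) (no-Y₂ i) (no-Y₂ j)))
  sizes-σ : ∀ p → size (σ ∘ L) p ≡ size (F₁-parts K) p
  sizes-σ p = trans (size-relabel σ σ-involutive L p) (trans (sized (σ p)) (sym (trans (size-F₁-parts K p) (swapped p))))
    where
    swapped : ∀ p → sizes 1 K 1 0 p ≡ sizes 1 1 K 0 (σ p)
    swapped U = refl ; swapped X = refl ; swapped Y₁ = refl ; swapped Y₂ = refl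
extremal-iso G L shaped {K} sized pendant-path-at-Y =
  inj₂ (shaped-iso G (F₂ (suc K)) (τ ∘ L) (F₂-parts K) τ-shaped (F₂-irrefl (suc K)) (F₂-shaped K) sizes-τ)
  where
  τ-shaped : Shaped (adj G) (τ ∘ L)
  τ-shaped i j i≢j = trans (shaped i j i≢j) (sym (τ-joined (L i) (L j)))
  sizes-τ : ∀ p → size (τ ∘ L) p ≡ size (F₂-parts K) p
  sizes-τ p = trans (size-relabel τ τ-involutive L p) (trans (sized (τ p)) (sym (trans (size-F₂-parts K p) (swapped p))))
    where
    swapped : ∀ p → sizes 1 K 1 1 p ≡ sizes 1 1 1 K (τ p)
    swapped U = refl ; swapped X = refl ; swapped Y₁ = refl ; swapped Y₂ = refl

extremal-tight : ∀ {K a t′ s} y → Extremal K a t′ s → cutπ y a t′ s ≡ y ↓ K * y ^ (a + suc t′ + s ∸ K)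
extremal-tight {K} y pendant-edge =
  cong (y ↓ K *_) (trans (*-identityʳ (y * 1)) (cong (y ^_) (sym (trans (cong (_∸ K) (+-assoc K 1 0)) (m+n∸m≡n K 1)))))
extremal-tight {K} y pendant-path =
  cong (y ↓ K *_) (trans (square y) (cong (y ^_) (sym (trans (cong (_∸ K) (+-assoc K 1 1)) (m+n∸m≡n K 2)))))
  where
  square : ∀ y → y * 1 * (y * 1) ≡ y * (y * 1)
  square = solve-∀
extremal-tight {suc t′} y pendant-edge-at-Y =
  trans (swap y (y ↓ suc t′))
        (cong (λ e → y ↓ suc t′ * y ^ e) (sym (trans (cong (_∸ suc t′) (+-identityʳ (1 + suc t′))) (m+n∸n≡m 1 (suc t′)))))
  where
  swap : ∀ y F → y * 1 * (F * 1) ≡ F * (y * 1)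
  swap = solve-∀
extremal-tight {s} y pendant-path-at-Y =
  trans (swap y (y ↓ s)) (cong (λ e → y ↓ s * y ^ e) (sym (m+n∸n≡m 2 s)))
  where
  swap : ∀ y F → y * 1 * (y * 1 * F) ≡ F * (y * (y * 1))
  swap = solve-∀

module _ {n} {G : Graph n} {L : Fin n → Part} (shaped : Shaped (adj G) L)
         {a t′ s : ℕ} (sized : ∀ p → size L p ≡ sizes 1 a (suc t′) s p) where

  bound-form : ∀ y K → suc y ↓ suc K * (suc y ∸ 1) ^ (n ∸ suc K) ≡ suc y * (y ↓ K * y ^ (a + suc t′ + s ∸ K))
  bound-form y K rewrite order {G = G} shaped sized = *-assoc (suc y) (y ↓ K) _

  π-extremal : ∀ {K} y → Extremal K a t′ s → π G (suc y) ≡ suc y ↓ suc K * (suc y ∸ 1) ^ (n ∸ suc K)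
  π-extremal {K} y extremal =
    trans (π-cut {G = G} shaped sized y) (trans (cong (suc y *_) (extremal-tight y extremal)) (sym (bound-form y K)))

  π-bound : ∀ {K y} → 1 ≤ a → K ≡ a ⊔ (suc t′ ⊔ (t′ + s)) → K ≤ y →
    let rhs = suc y ↓ suc K * (suc y ∸ 1) ^ (n ∸ suc K) in π G (suc y) ≤ rhs × (π G (suc y) ≡ rhs → Extremal K a t′ s)
  π-bound {K} {y} 1≤a refl K≤y =
    let bound , tight = cutπ-bound 1≤a K≤y in
    ≤-trans (≤-reflexive (π-cut {G = G} shaped sized y)) (≤-trans (*-monoʳ-≤ (suc y) bound) (≤-reflexive (sym (bound-form y K)))) ,
    λ eq → tight (*-cancelˡ-≡ _ _ (suc y) (trans (sym (π-cut {G = G} shaped sized y)) (trans eq (bound-form y K))))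

lemma2p3 : ∀ {n} (G : Graph n) (k : ℕ) (u : Fin n) →
    Connected G → ChromaticNumber G k → IndependenceNumber G 2 → CutVertex G u →
    ∀ (x : ℕ) → k ≤ x →
    (π G x ≤ (x ↓ k) * ((x ∸ 1) ^ (n ∸ k)))
    × ((π G x ≡ (x ↓ k) * ((x ∸ 1) ^ (n ∸ k))) ⇔ (IsoTo G (F₁ k) ⊎ IsoTo G (F₂ k)))
lemma2p3 G zero    u _ ((colour , _) , _) _ _ _ _ with () ← colour u
lemma2p3 {n} G (suc K) u connected χ α cut (suc y) (s≤s K≤y) =
  proj₁ bound , mk⇔ (extremal-iso G part shaped sized ∘ proj₂ bound) iso⇒equality
  where
  open CutShape (cut-vertex-shape G u connected α cut)
  t′ = pred (size part Y₁)
  sized : ∀ p → size part p ≡ sizes 1 (size part X) (suc t′) (size part Y₂) p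
  sized U  = U-singleton
  sized X  = refl
  sized Y₁ = sym (suc-pred (size part Y₁) {{>-nonZero Y₁-nonempty}})
  sized Y₂ = refl
  bound = π-bound {G = G} shaped sized X-nonempty (χ-shaped {G = G} shaped sized χ) K≤y
  iso⇒equality : IsoTo G (F₁ (suc K)) ⊎ IsoTo G (F₂ (suc K)) → π G (suc y) ≡ suc y ↓ suc K * (suc y ∸ 1) ^ (n ∸ suc K)
  iso⇒equality (inj₁ iso) = let shaped′ , sized′ = shaped-pullback G (F₁ (suc K)) (F₁-parts K) (F₁-shaped K) iso in
    π-extremal {G = G} shaped′ (λ p → trans (sized′ p) (size-F₁-parts K p)) y pendant-edge
  iso⇒equality (inj₂ iso) = let shaped′ , sized′ = shaped-pullback G (F₂ (suc K)) (F₂-parts K) (F₂-shaped K) iso in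
    π-extremal {G = G} shaped′ (λ p → trans (sized′ p) (size-F₂-parts K p)) y pendant-path
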